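{- Let $k,\ell\ge1$, $\tau\in S_k$, $\rho\in S_\ell$, and $a,b$ positive integers with $a\le k$, $b\le\ell$, $mmp^{(a,0,0,0)}(\tau)=0$ and $mmp^{(0,0,b,0)}(\rho)=0$. For $n\ge k+\ell$ let $S_n^{\overline{\beta\alpha}}$ be the set of $\sigma\in S_n$ that contain, in consecutive positions, a block $\beta\alpha$ where $\beta$ is the arrangement of the values $n-k+1,\dots,n$ whose reduction is $\tau$ and $\alpha$ is the arrangement of the values $1,\dots,\ell$ whose reduction is $\rho$; let $R_n^{(a,0,b,0),\overline{\beta\alpha}}(x)=\sum_{\sigma\in S_n^{\overline{\beta\alpha}}}x^{mmp^{(a,0,b,0)}(\sigma)}$. Then for $n\ge k+\ell$, \[ R_n^{(a,0,b,0),\overline{\beta\alpha}}(x)=\sum_{i=0}^{n-k-\ell}\binom{n-k-\ell}{i}R_i^{(0,0,b,0)}(x)R_{n-k-\ell-i}^{(a,0,0,0)}(x), \] and hence \[ \sum_{n\ge k+\ell}\frac{t^{n-k-\ell}}{(n-k-\ell)!}R_n^{(a,0,b,0),\overline{\beta\alpha}}(x)=R^{(a,0,0,0)}(t,x)\,R^{(0,0,b,0)}(t,x). \] In particular, $\sum_{n\ge2}\frac{t^{n-2}}{(n-2)!}R_n^{(1,0,1,0),\overline{n1}}(x)=(1-tx)^{ -2/x}$, where $\overline{n1}$ denotes the case $k=\ell=1$ (the block is $n$ immediately followed by $1$).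
   Context: For $\sigma=\sigma_1\cdots\sigma_n\in S_n$, $\sigma_i$ matches $MMP(a,b,c,d)$ ($a,b,c,d\in\mathbb{N}$) if there are at least $a$ indices $j>i$ with $\sigma_j>\sigma_i$, at least $b$ indices $j<i$ with $\sigma_j>\sigma_i$, at least $c$ indices $j<i$ with $\sigma_j<\sigma_i$, and at least $d$ indices $j>i$ with $\sigma_j<\sigma_i$. $mmp^{(a,b,c,d)}(\sigma)$ is the number of such $i$, $R_n^{(a,b,c,d)}(x)=\sum_{\sigma\in S_n}x^{mmp^{(a,b,c,d)}(\sigma)}$, $R_0^{(a,b,c,d)}(x)=1$, and $R^{(a,b,c,d)}(t,x)=\sum_{n\ge0}R_n^{(a,b,c,d)}(x)t^n/n!$. The reduction of a sequence of distinct integers replaces its $i$-th smallest entry by $i$. -}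

module Defs where

open import Data.Bool using (Bool; true; false; _∧_; _∨_; if_then_else_)
import Data.Bool as 𝔹
open import Data.Nat using (ℕ; zero; suc; _+_; _*_; _∸_; _≤ᵇ_; _<ᵇ_; _≡ᵇ_)
open import Data.List using (List; []; _∷_; _++_; map; filter; length; concatMap; sum; [_]; all; any)
open import Data.List.Relation.Unary.Unique.DecPropositional using (unique?)
import Data.Nat as ℕ
open import Relation.Nullary.Decidable using (does; ⌊_⌋)
open import Data.Nat.Combinatorics using (_C_)

oneTo : ℕ → List ℕ
oneTo zero    = []
oneTo (suc n) = oneTo n ++ [ suc n ]

words : ℕ → ℕ → List (List ℕ)
words zero    m = [] ∷ []
words (suc l) m = concatMap (λ v → map (v ∷_) (words l m)) (oneTo m)

Sym : ℕ → List (List ℕ)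
Sym n = filter (unique? ℕ._≟_) (words n n)

#gt : ℕ → List ℕ → ℕ
#gt v xs = length (filter (λ y → v ℕ.<? y) xs)

#lt : ℕ → List ℕ → ℕ
#lt v xs = length (filter (λ y → y ℕ.<? v) xs)

matchesMMP : ℕ → ℕ → ℕ → ℕ → List ℕ → ℕ → List ℕ → Bool
matchesMMP a b c d pre v suf =
  (a ≤ᵇ #gt v suf) ∧ (b ≤ᵇ #gt v pre) ∧ (c ≤ᵇ #lt v pre) ∧ (d ≤ᵇ #lt v suf)

mmpGo : ℕ → ℕ → ℕ → ℕ → List ℕ → List ℕ → ℕ
mmpGo a b c d pre []        = 0
mmpGo a b c d pre (v ∷ suf) =
  (if matchesMMP a b c d pre v suf then 1 else 0) + mmpGo a b c d (pre ++ [ v ]) suf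

mmp : ℕ → ℕ → ℕ → ℕ → List ℕ → ℕ
mmp a b c d σ = mmpGo a b c d [] σ

-- coefficient of x^m in R_n^{(a,b,c,d)}(x)
--   = #{ σ ∈ S_n : mmp^{(a,b,c,d)}(σ) = m }
Rcoeff : ℕ → ℕ → ℕ → ℕ → ℕ → ℕ → ℕ
Rcoeff a b c d n m = length (filter (λ σ → mmp a b c d σ ℕ.≟ m) (Sym n))

isPrefix : List ℕ → List ℕ → Bool
isPrefix []      u       = true
isPrefix (x ∷ w) []      = false
isPrefix (x ∷ w) (y ∷ u) = (x ≡ᵇ y) ∧ isPrefix w u

containsBlock : List ℕ → List ℕ → Bool
containsBlock w []      = isPrefix w []
containsBlock w (y ∷ u) = isPrefix w (y ∷ u) ∨ containsBlock w u

-- the block βα for σ ∈ S_n: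
--   β = arrangement of n-k+1..n with reduction τ (τ ∈ S_k), i.e. τ shifted by n-k,
--   α = arrangement of 1..ℓ with reduction ρ (ρ ∈ S_ℓ), i.e. ρ itself
blockβα : ℕ → ℕ → List ℕ → List ℕ → List ℕ
blockβα n k τ ρ = map (λ v → v + (n ∸ k)) τ ++ ρ

-- coefficient of x^m in R_n^{(a,b,c,d),βα}(x)
--   = #{ σ ∈ S_n^{βα} : mmp^{(a,b,c,d)}(σ) = m }
RbarCoeff : ℕ → ℕ → ℕ → ℕ → ℕ → List ℕ → List ℕ → ℕ → ℕ → ℕ
RbarCoeff a b c d k τ ρ n m =
  length (filter (λ σ → (containsBlock (blockβα n k τ ρ) σ ∧ (mmp a b c d σ ≡ᵇ m)) 𝔹.≟ true) (Sym n))

sumTo : ℕ → (ℕ → ℕ) → ℕ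
sumTo zero    f = f 0
sumTo (suc N) f = sumTo N f + f (suc N)

-- coefficient of x^m in the product of polynomials with coefficient functions p, q
convCoeff : (ℕ → ℕ) → (ℕ → ℕ) → ℕ → ℕ
convCoeff p q m = sumTo m (λ j → p j * q (m ∸ j))

-- coefficient of x^m in Π_{j=0}^{M-1} (2 + j x)
risingCoeff : ℕ → ℕ → ℕ
risingCoeff zero    zero    = 1
risingCoeff zero    (suc m) = 0
risingCoeff (suc M) zero    = 2 * risingCoeff M zero
risingCoeff (suc M) (suc m) = 2 * risingCoeff M (suc m) + M * risingCoeff M m

-- A permutation containing the block βα is L ++ βα ++ R, where L ++ R consists exactly of the
-- middle values ℓ+1, …, n−k.  Each entry of β exceeds them all and each entry of α lies below them
-- all, so an entry of L has k ≥ a larger entries to its right and an entry of R has ℓ ≥ b smaller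
-- entries to its left, while no entry of β or α matches: the rest of the word lies below β and
-- above α, and mmp^{(a,0,0,0)}(τ) = mmp^{(0,0,b,0)}(ρ) = 0.  Hence
-- mmp^{(a,0,b,0)}(L ++ βα ++ R) = mmp^{(0,0,b,0)}(L) + mmp^{(a,0,0,0)}(R), and since mmp depends
-- only on relative order, choosing the value set of L and then the orders of L and R independently
-- gives the binomial convolution.
--
-- For k = ℓ = 1, inserting a new minimum (maximum) into π ∈ S_i raises mmp^{(1,0,0,0)}
-- (mmp^{(0,0,1,0)}) by one at all but one of the i + 1 places, so both R_i^{(1,0,0,0)} and
-- R_i^{(0,0,1,0)} equal Π_{j<i} (1 + j x).  Putting one more element on either side of a split
-- multiplies Π_{j<i} (1 + j x) · Π_{j<i′} (1 + j x) by (1 + i x) + (1 + i′ x) = 2 + (i + i′) x,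
-- whence the binomial convolution of these products is Π_{j<N} (2 + j x).

module Submission where

open import Defs
open import Data.Bool using (Bool; true; false; _∧_; if_then_else_; T)
import Data.Bool as 𝔹
open import Data.Bool.Properties using (∨-zeroʳ)
open import Data.Empty using (⊥; ⊥-elim)
open import Data.Unit using (tt)
open import Data.Nat using (ℕ; zero; suc; _+_; _*_; _∸_; _≤_; _<_; z≤n; s≤s; _≟_; _≤ᵇ_; _<?_; _≤?_; _≡ᵇ_)
open import Data.Nat.Properties
open import Data.Nat.Combinatorics using (_C_; nCk+nC[k+1]≡[n+1]C[k+1]; k>n⇒nCk≡0)
open import Data.Nat.ListAction using (sum)
open import Data.Nat.ListAction.Properties using (sum-++)
open import Data.Nat.Tactic.RingSolver using (solve-∀)
open import Data.List using (List; []; _∷_; _++_; map; filter; length; concatMap; [_]; cartesianProduct; replicate; zip)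
open import Data.List.Properties hiding (sum-++)
open import Data.List.Membership.Propositional using (_∈_; _∉_; find; lose)
open import Data.List.Membership.Propositional.Properties
open import Data.List.Membership.Propositional.Properties.WithK using (unique∧set⇒bag)
open import Data.List.Membership.DecPropositional _≟_ using (_∈?_)
open import Data.List.Relation.Unary.Any using (here; there)
import Data.List.Relation.Unary.Any as Any
open import Data.List.Relation.Unary.All using (All; []; _∷_)
import Data.List.Relation.Unary.All as All
open import Data.List.Relation.Unary.AllPairs using (AllPairs; []; _∷_)
import Data.List.Relation.Unary.AllPairs as AllPairs
import Data.List.Relation.Unary.AllPairs.Properties as AllPairsₚ
open import Data.List.Relation.Unary.Unique.Propositional using (Unique)
import Data.List.Relation.Unary.Unique.Propositional.Properties as Uniqueₚ
open import Data.List.Relation.Unary.Unique.DecPropositional using (unique?)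
open import Data.List.Relation.Binary.BagAndSetEquality using (∼bag⇒↭)
open import Data.List.Relation.Binary.Permutation.Propositional using (_↭_; ↭-refl; ↭-sym; ↭-trans; ↭-prep; ↭⇒↭ₛ)
open import Data.List.Relation.Binary.Permutation.Propositional.Properties
  using (shift; drop-mid; ↭-empty-inv; ∈-resp-↭; ↭-length; filter-↭; ++-comm)
import Data.List.Relation.Binary.Permutation.Setoid.Properties as ↭ₛ
open import Data.Product using (∃; ∃₂; _×_; _,_; proj₁; proj₂)
open import Data.Sum using (_⊎_; inj₁; inj₂)
open import Function.Bundles using (mk⇔)
open import Relation.Nullary using (¬_; Dec; yes; no)
open import Relation.Nullary.Decidable using (¬?)
open import Relation.Binary.PropositionalEquality hiding ([_])

private
  variable
    A B : Set

∈-concatMap⁻′ : (f : A → List B) (xs : List A) {z : B} →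
  z ∈ concatMap f xs → ∃ λ x → x ∈ xs × z ∈ f x
∈-concatMap⁻′ f xs z∈ = find (∈-concatMap⁻ f z∈)

∈-concatMap⁺′ : (f : A → List B) {xs : List A} {x : A} {z : B} →
  x ∈ xs → z ∈ f x → z ∈ concatMap f xs
∈-concatMap⁺′ f x∈ z∈ = ∈-concatMap⁺ f (lose x∈ z∈)

unique∧sameElements⇒↭ : {xs ys : List A} → Unique xs → Unique ys →
  (∀ {z} → z ∈ xs → z ∈ ys) → (∀ {z} → z ∈ ys → z ∈ xs) → xs ↭ ys
unique∧sameElements⇒↭ ux uy f g = ∼bag⇒↭ (unique∧set⇒bag ux uy (mk⇔ f g))

Unique-concatMap⁺ : (f : A → List B) {xs : List A} → Unique xs →
  (∀ {x} → x ∈ xs → Unique (f x)) →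
  (∀ {x y z} → x ∈ xs → y ∈ xs → z ∈ f x → z ∈ f y → x ≡ y) →
  Unique (concatMap f xs)
Unique-concatMap⁺ f {[]} _ _ _ = []
Unique-concatMap⁺ f {x ∷ xs} u@(_ ∷ u′) uf df =
  Uniqueₚ.++⁺ (uf (here refl))
    (Unique-concatMap⁺ f u′ (λ x∈ → uf (there x∈)) (λ p q → df (there p) (there q)))
    λ { (z∈fx , z∈rest) → let (y , y∈ , z∈fy) = ∈-concatMap⁻′ f xs z∈rest in
        Uniqueₚ.Unique[x∷xs]⇒x∉xs u (subst (_∈ xs) (sym (df (here refl) (there y∈) z∈fx z∈fy)) y∈) }

Unique-map⁺-injectiveOn : (f : A → B) {xs : List A} → Unique xs →
  (∀ {x y} → x ∈ xs → y ∈ xs → f x ≡ f y → x ≡ y) → Unique (map f xs)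
Unique-map⁺-injectiveOn f {[]} _ _ = []
Unique-map⁺-injectiveOn f {x ∷ xs} (x∉ ∷ u) inj =
  All.tabulate (λ y∈ fx≡y → let (y′ , y′∈ , y≡fy′) = ∈-map⁻ f y∈ in
                  All.lookup x∉ y′∈ (inj (here refl) (there y′∈) (trans fx≡y y≡fy′)))
  ∷ Unique-map⁺-injectiveOn f u (λ p q → inj (there p) (there q))

Unique-++⁻ : {xs ys : List A} → Unique (xs ++ ys) →
  Unique xs × Unique ys × (∀ {z} → z ∈ xs → z ∈ ys → ⊥)
Unique-++⁻ {xs = []} u = [] , u , λ ()
Unique-++⁻ {xs = x ∷ xs} (x∉ ∷ u) with Unique-++⁻ {xs = xs} u
... | ux , uy , disj =
  All.tabulate (λ z∈ → All.lookup x∉ (∈-++⁺ˡ z∈)) ∷ ux , uy ,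
  λ { (here refl) z∈ys → All.lookup x∉ (∈-++⁺ʳ xs z∈ys) refl ; (there p) q → disj p q }

++-cancel-∉ : {x : A} (a a′ : List A) {b b′ : List A} → x ∉ a → x ∉ a′ →
  a ++ x ∷ b ≡ a′ ++ x ∷ b′ → a ≡ a′ × b ≡ b′
++-cancel-∉ []      []       _  _   eq = refl , ∷-injectiveʳ eq
++-cancel-∉ []      (y ∷ a′) _  x∉′ eq = ⊥-elim (x∉′ (here (∷-injectiveˡ eq)))
++-cancel-∉ (y ∷ a) []       x∉ _   eq = ⊥-elim (x∉ (here (sym (∷-injectiveˡ eq))))
++-cancel-∉ (y ∷ a) (y′ ∷ a′) x∉ x∉′ eq with ∷-injective eq
... | refl , eq′ with ++-cancel-∉ a a′ (λ p → x∉ (there p)) (λ p → x∉′ (there p)) eq′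
... | refl , refl = refl , refl

++-cancel-block : (w : List A) {a a′ c c′ : List A} →
  (∀ {z} → z ∈ a → z ∈ w → ⊥) → (∀ {z} → z ∈ a′ → z ∈ w → ⊥) →
  0 < length w → a ++ w ++ c ≡ a′ ++ w ++ c′ → a ≡ a′ × c ≡ c′
++-cancel-block (x ∷ w) {a} {a′} a∩w a′∩w _ e
  with ++-cancel-∉ a a′ (λ q → a∩w q (here refl)) (λ q → a′∩w q (here refl)) e
... | refl , e′ = refl , ++-cancelˡ w _ _ e′

Unique∧⊆⇒length≤ : {xs ys : List A} → Unique xs → (∀ {z} → z ∈ xs → z ∈ ys) →
  length xs ≤ length ys
Unique∧⊆⇒length≤ {xs = []} _ _ = z≤n
Unique∧⊆⇒length≤ {xs = x ∷ xs} (x∉ ∷ u) ⊆ys with ∈-∃++ (⊆ys (here refl))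
... | a , b , refl = subst (suc (length xs) ≤_) (sym length-a++x∷b) (s≤s (Unique∧⊆⇒length≤ u ⊆a++b))
  where
  ⊆a++b : ∀ {z} → z ∈ xs → z ∈ a ++ b
  ⊆a++b z∈ with ∈-++⁻ a (⊆ys (there z∈))
  ... | inj₁ p         = ∈-++⁺ˡ p
  ... | inj₂ (here refl) = ⊥-elim (All.lookup x∉ z∈ refl)
  ... | inj₂ (there p) = ∈-++⁺ʳ a p
  length-a++x∷b : length (a ++ x ∷ b) ≡ suc (length (a ++ b))
  length-a++x∷b = trans (length-++ a) (trans (+-suc (length a) (length b)) (cong suc (sym (length-++ a))))

Unique∧⊆∧length≥⇒⊇ : {xs ys : List ℕ} → Unique xs → length ys ≤ length xs →
  (∀ {z} → z ∈ xs → z ∈ ys) → ∀ {z} → z ∈ ys → z ∈ xs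
Unique∧⊆∧length≥⇒⊇ {xs} {ys} u ys≤xs ⊆ys {z} z∈ with Any.any? (z ≟_) xs
... | yes z∈xs = z∈xs
... | no  z∉xs = ⊥-elim (<-irrefl refl (≤-trans shorter (≤-trans ys≤xs (Unique∧⊆⇒length≤ u ⊆ys-z))))
  where
  ≢z? = λ y → ¬? (y ≟ z)
  ⊆ys-z : ∀ {w} → w ∈ xs → w ∈ filter ≢z? ys
  ⊆ys-z w∈ = ∈-filter⁺ ≢z? (⊆ys w∈) (λ { refl → z∉xs w∈ })
  shorter : length (filter ≢z? ys) < length ys
  shorter = filter-notAll ≢z? ys (Any.map (λ { refl ≢ → ≢ refl }) z∈)

-- count f xs m is the coefficient of x ^ m in Σ_{y ∈ xs} x ^ f y.
count : (A → ℕ) → List A → ℕ → ℕ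
count f xs m = length (filter (λ x → f x ≟ m) xs)

count-↭ : (f : A → ℕ) {xs ys : List A} (m : ℕ) → xs ↭ ys → count f xs m ≡ count f ys m
count-↭ f m p = ↭-length (filter-↭ (λ x → f x ≟ m) p)

count-++ : (f : A → ℕ) (xs ys : List A) (m : ℕ) → count f (xs ++ ys) m ≡ count f xs m + count f ys m
count-++ f xs ys m =
  trans (cong length (filter-++ (λ x → f x ≟ m) xs ys)) (length-++ (filter (λ x → f x ≟ m) xs))

count-accept : (f : A → ℕ) {x : A} (xs : List A) {m : ℕ} → f x ≡ m → count f (x ∷ xs) m ≡ suc (count f xs m)
count-accept f xs {m} e = cong length (filter-accept (λ y → f y ≟ m) e)

count-reject : (f : A → ℕ) {x : A} (xs : List A) {m : ℕ} → f x ≢ m → count f (x ∷ xs) m ≡ count f xs m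
count-reject f xs {m} e = cong length (filter-reject (λ y → f y ≟ m) e)

count-iff : (f g : A → ℕ) (xs : List A) (m m′ : ℕ) →
  (∀ {x} → x ∈ xs → (f x ≡ m → g x ≡ m′) × (g x ≡ m′ → f x ≡ m)) →
  count f xs m ≡ count g xs m′
count-iff f g []       m m′ h = refl
count-iff f g (x ∷ xs) m m′ h with f x ≟ m
... | yes e = trans (count-accept f xs e)
               (trans (cong suc (count-iff f g xs m m′ (λ q → h (there q))))
                 (sym (count-accept g xs (proj₁ (h (here refl)) e))))
... | no ¬e = trans (count-reject f xs ¬e)
               (trans (count-iff f g xs m m′ (λ q → h (there q)))
                 (sym (count-reject g xs (λ e → ¬e (proj₂ (h (here refl)) e)))))

count-congᴵⁿ : (f g : A → ℕ) (xs : List A) (m : ℕ) → (∀ {x} → x ∈ xs → f x ≡ g x) →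
  count f xs m ≡ count g xs m
count-congᴵⁿ f g xs m e = count-iff f g xs m m (λ x∈ → (trans (sym (e x∈))) , trans (e x∈))

count-none : (f : A → ℕ) (xs : List A) (m : ℕ) → (∀ {x} → x ∈ xs → f x ≢ m) → count f xs m ≡ 0
count-none f []       m h = refl
count-none f (x ∷ xs) m h = trans (count-reject f xs (h (here refl))) (count-none f xs m (λ q → h (there q)))

count-map : (f : B → ℕ) (g : A → B) (xs : List A) (m : ℕ) → count f (map g xs) m ≡ count (λ x → f (g x)) xs m
count-map f g []       m = refl
count-map f g (x ∷ xs) m with f (g x) ≟ m
... | yes e = trans (count-accept f (map g xs) e)
               (trans (cong suc (count-map f g xs m)) (sym (count-accept (λ y → f (g y)) xs e)))
... | no ¬e = trans (count-reject f (map g xs) ¬e)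
               (trans (count-map f g xs m) (sym (count-reject (λ y → f (g y)) xs ¬e)))

count-concatMap : (f : B → ℕ) (h : A → List B) (xs : List A) (m : ℕ) →
  count f (concatMap h xs) m ≡ sum (map (λ x → count f (h x) m) xs)
count-concatMap f h []       m = refl
count-concatMap f h (x ∷ xs) m =
  trans (count-++ f (h x) (concatMap h xs) m) (cong (count f (h x) m +_) (count-concatMap f h xs m))

δ : ℕ → ℕ → ℕ
δ c j = if c ≡ᵇ j then 1 else 0

δ-≡ : ∀ c → δ c c ≡ 1
δ-≡ c with c ≡ᵇ c in eq
... | true  = refl
... | false = ⊥-elim (subst T eq (≡⇒≡ᵇ c c refl))

δ-≢ : ∀ c j → c ≢ j → δ c j ≡ 0
δ-≢ c j c≢j with c ≡ᵇ j in eq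
... | true  = ⊥-elim (c≢j (≡ᵇ⇒≡ c j (subst T (sym eq) tt)))
... | false = refl

count-∷ : (f : A → ℕ) (x : A) (xs : List A) (j : ℕ) → count f (x ∷ xs) j ≡ δ (f x) j + count f xs j
count-∷ f x xs j with f x ≟ j
... | yes refl = trans (count-accept f xs refl) (cong (_+ count f xs j) (sym (δ-≡ (f x))))
... | no  ¬e   = trans (count-reject f xs ¬e) (cong (_+ count f xs j) (sym (δ-≢ (f x) j ¬e)))

sumTo-congᴵⁿ : ∀ N (f g : ℕ → ℕ) → (∀ i → i ≤ N → f i ≡ g i) → sumTo N f ≡ sumTo N g
sumTo-congᴵⁿ zero    f g h = h 0 z≤n
sumTo-congᴵⁿ (suc N) f g h =
  cong₂ _+_ (sumTo-congᴵⁿ N f g (λ i i≤N → h i (m≤n⇒m≤1+n i≤N))) (h (suc N) ≤-refl)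

sumTo-cong : ∀ N {f g : ℕ → ℕ} → (∀ i → f i ≡ g i) → sumTo N f ≡ sumTo N g
sumTo-cong N {f} {g} h = sumTo-congᴵⁿ N f g (λ i _ → h i)

sumTo-+ : ∀ N (f g : ℕ → ℕ) → sumTo N (λ i → f i + g i) ≡ sumTo N f + sumTo N g
sumTo-+ zero    f g = refl
sumTo-+ (suc N) f g rewrite sumTo-+ N f g =
  +-exch (sumTo N f) (sumTo N g) (f (suc N)) (g (suc N))
  where
  +-exch : ∀ a b c d → (a + b) + (c + d) ≡ (a + c) + (b + d)
  +-exch = solve-∀

sumTo-* : ∀ N c (f : ℕ → ℕ) → sumTo N (λ i → c * f i) ≡ c * sumTo N f
sumTo-* zero    c f = refl
sumTo-* (suc N) c f rewrite sumTo-* N c f = sym (*-distribˡ-+ c (sumTo N f) (f (suc N)))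

sumTo-zero : ∀ N → sumTo N (λ _ → 0) ≡ 0
sumTo-zero zero    = refl
sumTo-zero (suc N) rewrite sumTo-zero N = refl

sumTo-suc : ∀ N (f : ℕ → ℕ) → sumTo (suc N) f ≡ f 0 + sumTo N (λ i → f (suc i))
sumTo-suc zero    f = refl
sumTo-suc (suc N) f rewrite sumTo-suc N f = +-assoc (f 0) _ _

sumTo-δ-> : ∀ c m (h : ℕ → ℕ) → m < c → sumTo m (λ j → δ c j * h j) ≡ 0
sumTo-δ-> c zero    h m<c rewrite δ-≢ c 0 (λ { refl → <-irrefl refl m<c }) = refl
sumTo-δ-> c (suc m) h m<c
  rewrite δ-≢ c (suc m) (λ { refl → <-irrefl refl m<c }) | sumTo-δ-> c m h (<-trans (n<1+n m) m<c) = refl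

sumTo-δ-≤ : ∀ c m (h : ℕ → ℕ) → c ≤ m → sumTo m (λ j → δ c j * h j) ≡ h c
sumTo-δ-≤ c zero h z≤n rewrite δ-≡ 0 = +-identityʳ (h 0)
sumTo-δ-≤ c (suc m) h c≤m with m≤n⇒m<n∨m≡n c≤m
... | inj₁ (s≤s c≤m′) rewrite δ-≢ c (suc m) (λ { refl → <-irrefl refl (s≤s c≤m′) }) | sumTo-δ-≤ c m h c≤m′ =
  +-identityʳ (h c)
... | inj₂ refl rewrite δ-≡ (suc m) | sumTo-δ-> (suc m) m h (n<1+n m) = +-identityʳ (h (suc m))

convCoeff-cong : ∀ {p p′ q q′ : ℕ → ℕ} m → (∀ j → p j ≡ p′ j) → (∀ j → q j ≡ q′ j) →
  convCoeff p q m ≡ convCoeff p′ q′ m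
convCoeff-cong m hp hq = sumTo-cong m (λ j → cong₂ _*_ (hp j) (hq (m ∸ j)))

count-+ˡ : ∀ c (g : A → ℕ) (xs : List A) m → count (λ x → c + g x) xs m ≡ sumTo m (λ j → δ c j * count g xs (m ∸ j))
count-+ˡ c g xs m with c ≤? m
... | yes c≤m =
  trans (count-iff _ _ xs m (m ∸ c) (λ _ → (λ e → trans (sym (m+n∸m≡n c _)) (cong (_∸ c) e)) ,
                                            (λ e → trans (cong (c +_) e) (m+[n∸m]≡n c≤m))))
        (sym (sumTo-δ-≤ c m (λ j → count g xs (m ∸ j)) c≤m))
... | no c≰m =
  trans (count-none _ xs m (λ _ e → c≰m (subst (c ≤_) e (m≤m+n c _))))
        (sym (sumTo-δ-> c m _ (≰⇒> c≰m)))

count-cartesianProduct : (f : A → ℕ) (g : B → ℕ) (xs : List A) (ys : List B) (m : ℕ) →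
  count (λ p → f (proj₁ p) + g (proj₂ p)) (cartesianProduct xs ys) m ≡ convCoeff (count f xs) (count g ys) m
count-cartesianProduct f g []       ys m = sym (sumTo-zero m)
count-cartesianProduct f g (x ∷ xs) ys m =
  begin
    count F (map (x ,_) ys ++ cartesianProduct xs ys) m
  ≡⟨ count-++ F (map (x ,_) ys) (cartesianProduct xs ys) m ⟩
    count F (map (x ,_) ys) m + count F (cartesianProduct xs ys) m
  ≡⟨ cong₂ _+_ (trans (count-map F (x ,_) ys m) (count-+ˡ (f x) g ys m)) (count-cartesianProduct f g xs ys m) ⟩
    sumTo m (λ j → δ (f x) j * count g ys (m ∸ j)) + sumTo m (λ j → count f xs j * count g ys (m ∸ j))
  ≡⟨ sym (sumTo-+ m _ _) ⟩
    sumTo m (λ j → δ (f x) j * count g ys (m ∸ j) + count f xs j * count g ys (m ∸ j))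
  ≡⟨ sumTo-cong m (λ j → trans (sym (*-distribʳ-+ (count g ys (m ∸ j)) (δ (f x) j) (count f xs j)))
                                (cong (_* count g ys (m ∸ j)) (sym (count-∷ f x xs j)))) ⟩
    convCoeff (count f (x ∷ xs)) (count g ys) m
  ∎
  where
  open ≡-Reasoning
  F = λ (p : _ × _) → f (proj₁ p) + g (proj₂ p)

-- Enumerating permutations by insertion

insertions : A → List A → List (List A)
insertions x []       = [ [ x ] ]
insertions x (y ∷ ys) = (x ∷ y ∷ ys) ∷ map (y ∷_) (insertions x ys)

permutations : List A → List (List A)
permutations []       = [ [] ]
permutations (x ∷ xs) = concatMap (insertions x) (permutations xs)

∈-insertions⁻ : (x : A) (ys : List A) {σ : List A} → σ ∈ insertions x ys →
  ∃₂ λ a b → ys ≡ a ++ b × σ ≡ a ++ x ∷ b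
∈-insertions⁻ x []       (here refl) = [] , [] , refl , refl
∈-insertions⁻ x (y ∷ ys) (here refl) = [] , y ∷ ys , refl , refl
∈-insertions⁻ x (y ∷ ys) (there p) with ∈-map⁻ (y ∷_) p
... | σ , σ∈ , refl with ∈-insertions⁻ x ys σ∈
... | a , b , refl , refl = y ∷ a , b , refl , refl

∈-insertions⁺ : (x : A) (a b : List A) → a ++ x ∷ b ∈ insertions x (a ++ b)
∈-insertions⁺ x []      []      = here refl
∈-insertions⁺ x []      (y ∷ b) = here refl
∈-insertions⁺ x (y ∷ a) b       = there (∈-map⁺ (y ∷_) (∈-insertions⁺ x a b))

∈-permutations⁻ : (xs : List A) {σ : List A} → σ ∈ permutations xs → σ ↭ xs
∈-permutations⁻ []       (here refl) = ↭-refl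
∈-permutations⁻ (x ∷ xs) p with ∈-concatMap⁻′ (insertions x) (permutations xs) p
... | τ , τ∈ , σ∈ with ∈-insertions⁻ x τ σ∈
... | a , b , refl , refl = ↭-trans (shift x a b) (↭-prep x (∈-permutations⁻ xs τ∈))

∈-permutations⁺ : (xs : List A) {σ : List A} → σ ↭ xs → σ ∈ permutations xs
∈-permutations⁺ []       p rewrite ↭-empty-inv p = here refl
∈-permutations⁺ (x ∷ xs) p with ∈-∃++ (∈-resp-↭ (↭-sym p) (here refl))
... | a , b , refl =
  ∈-concatMap⁺′ (insertions x) (∈-permutations⁺ xs (drop-mid a [] p)) (∈-insertions⁺ x a b)

insertions-map : (g : A → B) (x : A) (ys : List A) →
  insertions (g x) (map g ys) ≡ map (map g) (insertions x ys)
insertions-map g x []       = refl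
insertions-map g x (y ∷ ys) =
  cong ((g x ∷ g y ∷ map g ys) ∷_)
    (trans (cong (map (g y ∷_)) (insertions-map g x ys))
      (trans (sym (map-∘ (insertions x ys))) (map-∘ (insertions x ys))))

permutations-map : (g : A → B) (xs : List A) → permutations (map g xs) ≡ map (map g) (permutations xs)
permutations-map g []       = refl
permutations-map g (x ∷ xs) rewrite permutations-map g xs = go (permutations xs)
  where
  go : ∀ τs → concatMap (insertions (g x)) (map (map g) τs) ≡ map (map g) (concatMap (insertions x) τs)
  go []       = refl
  go (τ ∷ τs) = trans (cong₂ _++_ (insertions-map g x τ) (go τs))
                      (sym (map-++ (map g) (insertions x τ) (concatMap (insertions x) τs)))

Unique-insertions : (x : A) (ys : List A) → x ∉ ys → Unique (insertions x ys)
Unique-insertions x []       x∉ = [] ∷ []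
Unique-insertions x (y ∷ ys) x∉ =
  All.tabulate (λ σ∈ eq → let (_ , _ , e) = ∈-map⁻ (y ∷_) σ∈ in x∉ (here (∷-injectiveˡ (trans eq e))))
  ∷ Uniqueₚ.map⁺ ∷-injectiveʳ (Unique-insertions x ys (λ p → x∉ (there p)))

Unique-permutations : (xs : List A) → Unique xs → Unique (permutations xs)
Unique-permutations []       _ = [] ∷ []
Unique-permutations (x ∷ xs) u@(_ ∷ u′) =
  Unique-concatMap⁺ (insertions x) (Unique-permutations xs u′)
    (λ {τ} τ∈ → Unique-insertions x τ (x∉ τ∈))
    (λ {τ₁} {τ₂} p q → disjoint τ₁ τ₂ (x∉ p) (x∉ q))
  where
  x∉ : ∀ {τ} → τ ∈ permutations xs → x ∉ τ
  x∉ τ∈ x∈ = Uniqueₚ.Unique[x∷xs]⇒x∉xs u (∈-resp-↭ (∈-permutations⁻ xs τ∈) x∈)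
  disjoint : ∀ τ₁ τ₂ {σ} → x ∉ τ₁ → x ∉ τ₂ → σ ∈ insertions x τ₁ → σ ∈ insertions x τ₂ → τ₁ ≡ τ₂
  disjoint τ₁ τ₂ x∉₁ x∉₂ σ∈₁ σ∈₂ with ∈-insertions⁻ x τ₁ σ∈₁ | ∈-insertions⁻ x τ₂ σ∈₂
  ... | a , b , refl , refl | a′ , b′ , refl , e
    with ++-cancel-∉ a a′ (λ q → x∉₁ (∈-++⁺ˡ q)) (λ q → x∉₂ (∈-++⁺ˡ q)) e
  ... | refl , refl = refl

permutations-↭ : {xs ys : List A} → Unique xs → Unique ys → xs ↭ ys → permutations xs ↭ permutations ys
permutations-↭ {xs = xs} {ys} ux uy p =
  unique∧sameElements⇒↭ (Unique-permutations xs ux) (Unique-permutations ys uy)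
    (λ q → ∈-permutations⁺ ys (↭-trans (∈-permutations⁻ xs q) p))
    (λ q → ∈-permutations⁺ xs (↭-trans (∈-permutations⁻ ys q) (↭-sym p)))

Unique-resp-↭ : {xs ys : List A} → xs ↭ ys → Unique xs → Unique ys
Unique-resp-↭ {A = A} p = ↭ₛ.Unique-resp-↭ (setoid A) (↭⇒↭ₛ p)

∈-oneTo⁻ : ∀ n {z} → z ∈ oneTo n → 1 ≤ z × z ≤ n
∈-oneTo⁻ (suc n) p with ∈-++⁻ (oneTo n) p
... | inj₁ q = let (1≤z , z≤bound) = ∈-oneTo⁻ n q in 1≤z , m≤n⇒m≤1+n z≤bound
... | inj₂ (here refl) = s≤s z≤n , ≤-refl

∈-oneTo⁺ : ∀ n {z} → 1 ≤ z → z ≤ n → z ∈ oneTo n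
∈-oneTo⁺ zero    {suc z} _ ()
∈-oneTo⁺ (suc n) {z} 1≤z z≤1+n with m≤n⇒m<n∨m≡n z≤1+n
... | inj₁ (s≤s z≤n′) = ∈-++⁺ˡ (∈-oneTo⁺ n 1≤z z≤n′)
... | inj₂ refl       = ∈-++⁺ʳ (oneTo n) (here refl)

length-oneTo : ∀ n → length (oneTo n) ≡ n
length-oneTo zero    = refl
length-oneTo (suc n) =
  trans (length-++ (oneTo n)) (trans (+-comm (length (oneTo n)) 1) (cong suc (length-oneTo n)))

Increasing : List ℕ → Set
Increasing = AllPairs _<_

Increasing-oneTo : ∀ n → Increasing (oneTo n)
Increasing-oneTo zero    = []
Increasing-oneTo (suc n) = AllPairsₚ.++⁺ (Increasing-oneTo n) ([] ∷ [])
  (All.tabulate (λ z∈ → s≤s (proj₂ (∈-oneTo⁻ n z∈)) ∷ []))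

Increasing⇒Unique : {xs : List ℕ} → Increasing xs → Unique xs
Increasing⇒Unique []      = []
Increasing⇒Unique (h ∷ p) = All.map (λ lt eq → <-irrefl eq lt) h ∷ Increasing⇒Unique p

Unique-oneTo : ∀ n → Unique (oneTo n)
Unique-oneTo n = Increasing⇒Unique (Increasing-oneTo n)

∈-words⁻ : ∀ l m {σ} → σ ∈ words l m → length σ ≡ l × All (_∈ oneTo m) σ
∈-words⁻ zero    m (here refl) = refl , []
∈-words⁻ (suc l) m p with ∈-concatMap⁻′ (λ v → map (v ∷_) (words l m)) (oneTo m) p
... | v , v∈ , q with ∈-map⁻ (v ∷_) q
... | w , w∈ , refl with ∈-words⁻ l m w∈
... | e , a = cong suc e , v∈ ∷ a

∈-words⁺ : ∀ l m {σ} → length σ ≡ l → All (_∈ oneTo m) σ → σ ∈ words l m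
∈-words⁺ zero    m {[]}    e a        = here refl
∈-words⁺ (suc l) m {v ∷ σ} e (v∈ ∷ a) =
  ∈-concatMap⁺′ (λ v → map (v ∷_) (words l m)) v∈ (∈-map⁺ (v ∷_) (∈-words⁺ l m (suc-injective e) a))

Unique-words : ∀ l m → Unique (words l m)
Unique-words zero    m = [] ∷ []
Unique-words (suc l) m =
  Unique-concatMap⁺ (λ v → map (v ∷_) (words l m)) (Unique-oneTo m)
    (λ _ → Uniqueₚ.map⁺ ∷-injectiveʳ (Unique-words l m))
    λ {v} {w} _ _ p q → let (_ , _ , e₁) = ∈-map⁻ (v ∷_) p ; (_ , _ , e₂) = ∈-map⁻ (w ∷_) q in
                        ∷-injectiveˡ (trans (sym e₁) e₂)

IsPermutation : ℕ → List ℕ → Set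
IsPermutation n σ = length σ ≡ n × All (_∈ oneTo n) σ × Unique σ

∈-Sym⁻ : ∀ n {σ} → σ ∈ Sym n → IsPermutation n σ
∈-Sym⁻ n p with ∈-filter⁻ (unique? _≟_) p
... | w , u = let (e , a) = ∈-words⁻ n n w in e , a , u

∈-Sym⁺ : ∀ n {σ} → IsPermutation n σ → σ ∈ Sym n
∈-Sym⁺ n (e , a , u) = ∈-filter⁺ (unique? _≟_) (∈-words⁺ n n e a) u

Unique-Sym : ∀ n → Unique (Sym n)
Unique-Sym n = Uniqueₚ.filter⁺ (unique? _≟_) (Unique-words n n)

IsPermutation⇒↭ : ∀ n {σ} → IsPermutation n σ → σ ↭ oneTo n
IsPermutation⇒↭ n (e , a , u) =
  unique∧sameElements⇒↭ u (Unique-oneTo n) (All.lookup a)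
    (Unique∧⊆∧length≥⇒⊇ u (≤-reflexive (trans (length-oneTo n) (sym e))) (All.lookup a))

↭⇒IsPermutation : ∀ n {σ} → σ ↭ oneTo n → IsPermutation n σ
↭⇒IsPermutation n p =
  trans (↭-length p) (length-oneTo n) , All.tabulate (∈-resp-↭ p) , Unique-resp-↭ (↭-sym p) (Unique-oneTo n)

Sym↭permutations : ∀ n → Sym n ↭ permutations (oneTo n)
Sym↭permutations n =
  unique∧sameElements⇒↭ (Unique-Sym n) (Unique-permutations (oneTo n) (Unique-oneTo n))
    (λ p → ∈-permutations⁺ (oneTo n) (IsPermutation⇒↭ n (∈-Sym⁻ n p)))
    (λ p → ∈-Sym⁺ n (↭⇒IsPermutation n (∈-permutations⁻ (oneTo n) p)))

-- mmp depends only on relative order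

≤⇒≤ᵇ≡true : ∀ {m n} → m ≤ n → (m ≤ᵇ n) ≡ true
≤⇒≤ᵇ≡true {m} {n} le with m ≤ᵇ n in eq
... | true  = refl
... | false = ⊥-elim (subst T eq (≤⇒≤ᵇ le))

length-filter-map-iff : {P Q : ℕ → Set} (P? : ∀ x → Dec (P x)) (Q? : ∀ x → Dec (Q x)) (f g : A → ℕ) (xs : List A) →
  (∀ {x} → x ∈ xs → (P (f x) → Q (g x)) × (Q (g x) → P (f x))) →
  length (filter P? (map f xs)) ≡ length (filter Q? (map g xs))
length-filter-map-iff P? Q? f g []       h = refl
length-filter-map-iff P? Q? f g (x ∷ xs) h with P? (f x) | Q? (g x)
... | yes _ | yes _ = cong suc (length-filter-map-iff P? Q? f g xs (λ r → h (there r)))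
... | no  _ | no  _ = length-filter-map-iff P? Q? f g xs (λ r → h (there r))
... | yes p | no ¬q = ⊥-elim (¬q (proj₁ (h (here refl)) p))
... | no ¬p | yes q = ⊥-elim (¬p (proj₂ (h (here refl)) q))

OrderConsistent : List (ℕ × ℕ) → Set
OrderConsistent X = ∀ {p q} → p ∈ X → q ∈ X →
  (proj₁ p < proj₁ q → proj₂ p < proj₂ q) × (proj₂ p < proj₂ q → proj₁ p < proj₁ q)

module _ (a b c d : ℕ) {X : List (ℕ × ℕ)} (consistent : OrderConsistent X) where

  private
    _⊆X : List (ℕ × ℕ) → Set
    xs ⊆X = ∀ {q} → q ∈ xs → q ∈ X

  mmpGo-relabel : ∀ pre suf → pre ⊆X → suf ⊆X →
    mmpGo a b c d (map proj₁ pre) (map proj₁ suf) ≡ mmpGo a b c d (map proj₂ pre) (map proj₂ suf)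
  mmpGo-relabel pre []        _  _  = refl
  mmpGo-relabel pre (v ∷ suf) sp ss =
    cong₂ _+_ (cong (λ z → if z then 1 else 0) sameMatch)
      (trans (cong (λ z → mmpGo a b c d z (map proj₁ suf)) (sym (map-++ proj₁ pre [ v ])))
        (trans (mmpGo-relabel (pre ++ [ v ]) suf sp′ (λ q → ss (there q)))
          (cong (λ z → mmpGo a b c d z (map proj₂ suf)) (map-++ proj₂ pre [ v ]))))
    where
    v∈ = ss (here refl)
    sp′ : (pre ++ [ v ]) ⊆X
    sp′ q with ∈-++⁻ pre q
    ... | inj₁ r         = sp r
    ... | inj₂ (here refl) = v∈
    #gt-relabel : ∀ xs → xs ⊆X → #gt (proj₁ v) (map proj₁ xs) ≡ #gt (proj₂ v) (map proj₂ xs)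
    #gt-relabel xs s = length-filter-map-iff (proj₁ v <?_) (proj₂ v <?_) proj₁ proj₂ xs (λ q∈ → consistent v∈ (s q∈))
    #lt-relabel : ∀ xs → xs ⊆X → #lt (proj₁ v) (map proj₁ xs) ≡ #lt (proj₂ v) (map proj₂ xs)
    #lt-relabel xs s = length-filter-map-iff (_<? proj₁ v) (_<? proj₂ v) proj₁ proj₂ xs (λ q∈ → consistent (s q∈) v∈)
    sameMatch : matchesMMP a b c d (map proj₁ pre) (proj₁ v) (map proj₁ suf)
              ≡ matchesMMP a b c d (map proj₂ pre) (proj₂ v) (map proj₂ suf)
    sameMatch rewrite #gt-relabel suf (λ q → ss (there q)) | #gt-relabel pre sp
                    | #lt-relabel pre sp | #lt-relabel suf (λ q → ss (there q)) = refl

  mmp-relabel : ∀ π → π ⊆X → mmp a b c d (map proj₁ π) ≡ mmp a b c d (map proj₂ π)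
  mmp-relabel π = mmpGo-relabel [] π (λ ())

∈-zip⁻ : ∀ {xs ys : List ℕ} {q} → q ∈ zip xs ys → proj₁ q ∈ xs × proj₂ q ∈ ys
∈-zip⁻ {x ∷ xs} {y ∷ ys} (here refl) = here refl , here refl
∈-zip⁻ {x ∷ xs} {y ∷ ys} (there p) = let (p₁ , p₂) = ∈-zip⁻ {xs} {ys} p in there p₁ , there p₂

OrderConsistent-zip : ∀ {xs ys : List ℕ} → Increasing xs → Increasing ys → OrderConsistent (zip xs ys)
OrderConsistent-zip {x ∷ xs} {y ∷ ys} _ _ (here refl) (here refl) =
  (λ lt → ⊥-elim (<-irrefl refl lt)) , (λ lt → ⊥-elim (<-irrefl refl lt))
OrderConsistent-zip {x ∷ xs} {y ∷ ys} (x< ∷ _) (y< ∷ _) (here refl) (there q) =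
  let (p₁ , p₂) = ∈-zip⁻ {xs} {ys} q in (λ _ → All.lookup y< p₂) , (λ _ → All.lookup x< p₁)
OrderConsistent-zip {x ∷ xs} {y ∷ ys} (x< ∷ _) (y< ∷ _) (there p) (here refl) =
  let (p₁ , p₂) = ∈-zip⁻ {xs} {ys} p in
  (λ lt → ⊥-elim (<-asym lt (All.lookup x< p₁))) , (λ lt → ⊥-elim (<-asym lt (All.lookup y< p₂)))
OrderConsistent-zip {x ∷ xs} {y ∷ ys} (_ ∷ sx) (_ ∷ sy) (there p) (there q) = OrderConsistent-zip sx sy p q

map-proj₁-zip : ∀ (xs ys : List ℕ) → length xs ≡ length ys → map proj₁ (zip xs ys) ≡ xs
map-proj₁-zip []       []       _ = refl
map-proj₁-zip (x ∷ xs) (y ∷ ys) e = cong (x ∷_) (map-proj₁-zip xs ys (suc-injective e))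

map-proj₂-zip : ∀ (xs ys : List ℕ) → length xs ≡ length ys → map proj₂ (zip xs ys) ≡ ys
map-proj₂-zip []       []       _ = refl
map-proj₂-zip (x ∷ xs) (y ∷ ys) e = cong (y ∷_) (map-proj₂-zip xs ys (suc-injective e))

count-mmp-permutations-sorted : ∀ a b c d {xs ys : List ℕ} → Increasing xs → Increasing ys → length xs ≡ length ys → ∀ m →
  count (mmp a b c d) (permutations xs) m ≡ count (mmp a b c d) (permutations ys) m
count-mmp-permutations-sorted a b c d {xs} {ys} sx sy e m =
  begin
    count st (permutations xs) m
  ≡⟨ cong (λ z → count st (permutations z) m) (sym (map-proj₁-zip xs ys e)) ⟩
    count st (permutations (map proj₁ X)) m
  ≡⟨ cong (λ z → count st z m) (permutations-map proj₁ X) ⟩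
    count st (map (map proj₁) (permutations X)) m
  ≡⟨ count-map st (map proj₁) (permutations X) m ⟩
    count (λ π → st (map proj₁ π)) (permutations X) m
  ≡⟨ count-congᴵⁿ _ _ (permutations X) m (λ {π} π∈ →
       mmp-relabel a b c d (OrderConsistent-zip sx sy) π (∈-resp-↭ (∈-permutations⁻ X π∈))) ⟩
    count (λ π → st (map proj₂ π)) (permutations X) m
  ≡⟨ sym (count-map st (map proj₂) (permutations X) m) ⟩
    count st (map (map proj₂) (permutations X)) m
  ≡⟨ cong (λ z → count st z m) (sym (permutations-map proj₂ X)) ⟩
    count st (permutations (map proj₂ X)) m
  ≡⟨ cong (λ z → count st (permutations z) m) (map-proj₂-zip xs ys e) ⟩
    count st (permutations ys) m
  ∎
  where
  open ≡-Reasoning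
  st = mmp a b c d
  X = zip xs ys

count-mmp-Sym : ∀ a b c d n m → count (mmp a b c d) (permutations (oneTo n)) m ≡ Rcoeff a b c d n m
count-mmp-Sym a b c d n m = sym (count-↭ (mmp a b c d) m (Sym↭permutations n))

count-mmp-permutations : ∀ a b c d {xs : List ℕ} → Increasing xs → ∀ m →
  count (mmp a b c d) (permutations xs) m ≡ Rcoeff a b c d (length xs) m
count-mmp-permutations a b c d {xs} sx m =
  trans (sym (count-mmp-permutations-sorted a b c d (Increasing-oneTo (length xs)) sx (length-oneTo (length xs)) m))
        (count-mmp-Sym a b c d (length xs) m)

-- mmp across a concatenation

mmpSegment : ℕ → ℕ → ℕ → ℕ → List ℕ → List ℕ → List ℕ → ℕ
mmpSegment a b c d pre []       post = 0
mmpSegment a b c d pre (v ∷ xs) post =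
  (if matchesMMP a b c d pre v (xs ++ post) then 1 else 0) + mmpSegment a b c d (pre ++ [ v ]) xs post

mmpGo≡mmpSegment : ∀ a b c d pre xs → mmpGo a b c d pre xs ≡ mmpSegment a b c d pre xs []
mmpGo≡mmpSegment a b c d pre []       = refl
mmpGo≡mmpSegment a b c d pre (v ∷ xs) rewrite ++-identityʳ xs =
  cong ((if matchesMMP a b c d pre v xs then 1 else 0) +_) (mmpGo≡mmpSegment a b c d (pre ++ [ v ]) xs)

mmp≡mmpSegment : ∀ a b c d σ → mmp a b c d σ ≡ mmpSegment a b c d [] σ []
mmp≡mmpSegment a b c d = mmpGo≡mmpSegment a b c d []

mmpSegment-++ : ∀ a b c d pre xs ys post →
  mmpSegment a b c d pre (xs ++ ys) post ≡ mmpSegment a b c d pre xs (ys ++ post) + mmpSegment a b c d (pre ++ xs) ys post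
mmpSegment-++ a b c d pre []       ys post rewrite ++-identityʳ pre = refl
mmpSegment-++ a b c d pre (v ∷ xs) ys post
  rewrite mmpSegment-++ a b c d (pre ++ [ v ]) xs ys post | ++-assoc xs ys post | ++-assoc pre [ v ] xs =
  sym (+-assoc (if matchesMMP a b c d pre v (xs ++ ys ++ post) then 1 else 0) _ _)

#gt-++ : ∀ v xs ys → #gt v (xs ++ ys) ≡ #gt v xs + #gt v ys
#gt-++ v xs ys = trans (cong length (filter-++ (v <?_) xs ys)) (length-++ (filter (v <?_) xs))

#lt-++ : ∀ v xs ys → #lt v (xs ++ ys) ≡ #lt v xs + #lt v ys
#lt-++ v xs ys = trans (cong length (filter-++ (_<? v) xs ys)) (length-++ (filter (_<? v) xs))

#gt-all : ∀ v xs → (∀ {y} → y ∈ xs → v < y) → #gt v xs ≡ length xs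
#gt-all v xs h = cong length (filter-all (v <?_) (All.tabulate h))

#gt-none : ∀ v xs → (∀ {y} → y ∈ xs → ¬ v < y) → #gt v xs ≡ 0
#gt-none v xs h = cong length (filter-none (v <?_) (All.tabulate h))

#lt-all : ∀ v xs → (∀ {y} → y ∈ xs → y < v) → #lt v xs ≡ length xs
#lt-all v xs h = cong length (filter-all (_<? v) (All.tabulate h))

#lt-none : ∀ v xs → (∀ {y} → y ∈ xs → ¬ y < v) → #lt v xs ≡ 0
#lt-none v xs h = cong length (filter-none (_<? v) (All.tabulate h))

#gt-shift : ∀ v s xs → #gt (v + s) (map (_+ s) xs) ≡ #gt v xs
#gt-shift v s xs =
  trans (length-filter-map-iff ((v + s) <?_) (v <?_) (_+ s) (λ u → u) xs (λ _ → +-cancelʳ-< s v _ , +-monoˡ-< s))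
        (cong (λ z → length (filter (v <?_) z)) (map-id xs))

#gt≤#gt-++ˡ : ∀ v xs ys → #gt v xs ≤ #gt v (xs ++ ys)
#gt≤#gt-++ˡ v xs ys = ≤-trans (m≤m+n _ _) (≤-reflexive (sym (#gt-++ v xs ys)))

#lt≤#lt-++ʳ : ∀ v xs ys → #lt v ys ≤ #lt v (xs ++ ys)
#lt≤#lt-++ʳ v xs ys = ≤-trans (m≤n+m _ _) (≤-reflexive (sym (#lt-++ v xs ys)))

indicator+≡0 : ∀ (x : Bool) r → (if x then 1 else 0) + r ≡ 0 → x ≡ false × r ≡ 0
indicator+≡0 false r e = refl , e

mmpSegment-largerRight : ∀ a b pre L post → (∀ {v} → v ∈ L → a ≤ #gt v post) →
  mmpSegment a 0 b 0 pre L post ≡ mmpSegment 0 0 b 0 pre L []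
mmpSegment-largerRight a b pre []      post h = refl
mmpSegment-largerRight a b pre (v ∷ L) post h
  rewrite ≤⇒≤ᵇ≡true {a} {#gt v (L ++ post)}
            (≤-trans (h (here refl)) (≤-trans (m≤n+m _ _) (≤-reflexive (sym (#gt-++ v L post))))) =
  cong (_ +_) (mmpSegment-largerRight a b (pre ++ [ v ]) L post (λ p → h (there p)))

mmpSegment-smallerLeft : ∀ a b P pre R → (∀ {v} → v ∈ R → b ≤ #lt v P) →
  mmpSegment a 0 b 0 (P ++ pre) R [] ≡ mmpSegment a 0 0 0 pre R []
mmpSegment-smallerLeft a b P pre []      h = refl
mmpSegment-smallerLeft a b P pre (v ∷ R) h
  rewrite ≤⇒≤ᵇ≡true {b} {#lt v (P ++ pre)}
            (≤-trans (h (here refl)) (≤-trans (m≤m+n _ _) (≤-reflexive (sym (#lt-++ v P pre))))) =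
  cong (_ +_) (trans (cong (λ z → mmpSegment a 0 b 0 z R []) (++-assoc P pre [ v ]))
                     (mmpSegment-smallerLeft a b P (pre ++ [ v ]) R (λ p → h (there p))))

mmpSegment-shifted-none : ∀ a b s pre q τ post → mmpSegment a 0 0 0 q τ [] ≡ 0 →
  (∀ {v y} → v ∈ τ → y ∈ post → ¬ (v + s < y)) →
  mmpSegment a 0 b 0 pre (map (_+ s) τ) post ≡ 0
mmpSegment-shifted-none a b s pre q []      post _  _ = refl
mmpSegment-shifted-none a b s pre q (v ∷ τ) post h0 h =
  cong₂ _+_ (cong (λ z → if z ∧ ((b ≤ᵇ #lt (v + s) pre) ∧ true) then 1 else 0) noMatch)
    (mmpSegment-shifted-none a b s (pre ++ [ v + s ]) (q ++ [ v ]) τ post (proj₂ (indicator+≡0 _ _ h0)) (λ p → h (there p)))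
  where
  ∧true : ∀ x → (x ∧ true) ≡ false → x ≡ false
  ∧true false _ = refl
  sameLarger : #gt (v + s) (map (_+ s) τ ++ post) ≡ #gt v (τ ++ [])
  sameLarger = trans (#gt-++ (v + s) (map (_+ s) τ) post)
    (trans (cong₂ _+_ (#gt-shift v s τ) (#gt-none (v + s) post (h (here refl))))
    (trans (+-identityʳ (#gt v τ)) (cong (#gt v) (sym (++-identityʳ τ)))))
  noMatch : (a ≤ᵇ #gt (v + s) (map (_+ s) τ ++ post)) ≡ false
  noMatch = trans (cong (a ≤ᵇ_) sameLarger) (∧true _ (proj₁ (indicator+≡0 _ _ h0)))

mmpSegment-belowPrefix-none : ∀ a b P pre ρ post → mmpSegment 0 0 b 0 pre ρ [] ≡ 0 →
  (∀ {v y} → v ∈ ρ → y ∈ P → ¬ (y < v)) →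
  mmpSegment a 0 b 0 (P ++ pre) ρ post ≡ 0
mmpSegment-belowPrefix-none a b P pre []      post _  _ = refl
mmpSegment-belowPrefix-none a b P pre (v ∷ ρ) post h0 h =
  cong₂ _+_ (cong (λ z → if z then 1 else 0) noMatch)
    (trans (cong (λ z → mmpSegment a 0 b 0 z ρ post) (++-assoc P pre [ v ]))
      (mmpSegment-belowPrefix-none a b P (pre ++ [ v ]) ρ post (proj₂ (indicator+≡0 _ _ h0)) (λ p → h (there p))))
  where
  G = #gt v (ρ ++ post)
  ∧false : ∀ x → (x ∧ false) ≡ false
  ∧false true  = refl
  ∧false false = refl
  sameSmaller : #lt v (P ++ pre) ≡ #lt v pre
  sameSmaller = trans (#lt-++ v P pre) (cong (_+ #lt v pre) (#lt-none v P (h (here refl))))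
  noMatch : matchesMMP a 0 b 0 (P ++ pre) v (ρ ++ post) ≡ false
  noMatch = trans (cong (λ z → (a ≤ᵇ G) ∧ ((b ≤ᵇ z) ∧ true)) sameSmaller)
    (trans (cong ((a ≤ᵇ G) ∧_) (proj₁ (indicator+≡0 _ _ h0))) (∧false _))

mmp-block-split : ∀ a b (L R τ ρ : List ℕ) s →
  mmp a 0 0 0 τ ≡ 0 → mmp 0 0 b 0 ρ ≡ 0 → a ≤ length τ → b ≤ length ρ →
  (∀ {v y} → v ∈ L ++ R → y ∈ τ → v < y + s) →
  (∀ {v y} → v ∈ L ++ R → y ∈ ρ → y < v) →
  (∀ {v y} → v ∈ ρ → y ∈ τ → v < y + s) →
  mmp a 0 b 0 (L ++ (map (_+ s) τ ++ ρ) ++ R) ≡ mmp 0 0 b 0 L + mmp a 0 0 0 R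
mmp-block-split a b L R τ ρ s hτ hρ a≤τ b≤ρ L,R<β ρ<L,R ρ<β =
  begin
    mmp a 0 b 0 (L ++ (β ++ ρ) ++ R)
  ≡⟨ mmp≡mmpSegment a 0 b 0 (L ++ (β ++ ρ) ++ R) ⟩
    seg [] (L ++ (β ++ ρ) ++ R) []
  ≡⟨ mmpSegment-++ a 0 b 0 [] L ((β ++ ρ) ++ R) [] ⟩
    seg [] L (((β ++ ρ) ++ R) ++ []) + seg L ((β ++ ρ) ++ R) []
  ≡⟨ cong₂ _+_ (trans (mmpSegment-largerRight a b [] L _ L-condition) (sym (mmp≡mmpSegment 0 0 b 0 L)))
               (mmpSegment-++ a 0 b 0 L (β ++ ρ) R []) ⟩
    mmp 0 0 b 0 L + (seg L (β ++ ρ) (R ++ []) + seg (L ++ (β ++ ρ)) R [])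
  ≡⟨ cong (λ z → mmp 0 0 b 0 L + (z + seg (L ++ (β ++ ρ)) R [])) (mmpSegment-++ a 0 b 0 L β ρ (R ++ [])) ⟩
    mmp 0 0 b 0 L + ((seg L β (ρ ++ R ++ []) + seg (L ++ β) ρ (R ++ [])) + seg (L ++ (β ++ ρ)) R [])
  ≡⟨ cong (λ z → mmp 0 0 b 0 L + (z + seg (L ++ (β ++ ρ)) R [])) (cong₂ _+_ β-none ρ-none) ⟩
    mmp 0 0 b 0 L + seg (L ++ (β ++ ρ)) R []
  ≡⟨ cong (mmp 0 0 b 0 L +_) R-part ⟩
    mmp 0 0 b 0 L + mmp a 0 0 0 R
  ∎
  where
  open ≡-Reasoning
  seg = mmpSegment a 0 b 0
  β = map (_+ s) τ
  ∈β⁻ : ∀ {y} → y ∈ β → ∃ λ u → u ∈ τ × y ≡ u + s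
  ∈β⁻ = ∈-map⁻ (_+ s)
  L-condition : ∀ {v} → v ∈ L → a ≤ #gt v (((β ++ ρ) ++ R) ++ [])
  L-condition {v} v∈ =
    ≤-trans a≤τ (≤-trans (≤-reflexive (trans (sym (length-map (_+ s) τ)) (sym (#gt-all v β v<β))))
      (≤-trans (#gt≤#gt-++ˡ v β ρ) (≤-trans (#gt≤#gt-++ˡ v (β ++ ρ) R) (#gt≤#gt-++ˡ v ((β ++ ρ) ++ R) []))))
    where
    v<β : ∀ {y} → y ∈ β → v < y
    v<β y∈ = let (u , u∈ , e) = ∈β⁻ y∈ in subst (v <_) (sym e) (L,R<β (∈-++⁺ˡ v∈) u∈)
  β-none : seg L β (ρ ++ R ++ []) ≡ 0
  β-none = mmpSegment-shifted-none a b s L [] τ (ρ ++ R ++ []) (trans (sym (mmp≡mmpSegment a 0 0 0 τ)) hτ) later≮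
    where
    later≮ : ∀ {v y} → v ∈ τ → y ∈ ρ ++ R ++ [] → ¬ (v + s < y)
    later≮ v∈ y∈ lt with ∈-++⁻ ρ y∈
    ... | inj₁ p = <-asym lt (ρ<β p v∈)
    ... | inj₂ p with ∈-++⁻ R p
    ... | inj₁ q = <-asym lt (L,R<β (∈-++⁺ʳ L q) v∈)
    ... | inj₂ ()
  ρ-none : seg (L ++ β) ρ (R ++ []) ≡ 0
  ρ-none = trans (cong (λ z → seg z ρ (R ++ [])) (sym (++-identityʳ (L ++ β))))
    (mmpSegment-belowPrefix-none a b (L ++ β) [] ρ (R ++ []) (trans (sym (mmp≡mmpSegment 0 0 b 0 ρ)) hρ) earlier≮)
    where
    earlier≮ : ∀ {v y} → v ∈ ρ → y ∈ L ++ β → ¬ (y < v)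
    earlier≮ v∈ y∈ lt with ∈-++⁻ L y∈
    ... | inj₁ p = <-asym lt (ρ<L,R (∈-++⁺ˡ p) v∈)
    ... | inj₂ p = let (u , u∈ , e) = ∈β⁻ p in <-asym lt (subst (_ <_) (sym e) (ρ<β v∈ u∈))
  R-part : seg (L ++ (β ++ ρ)) R [] ≡ mmp a 0 0 0 R
  R-part = trans (cong (λ z → seg z R []) (sym (++-identityʳ (L ++ (β ++ ρ)))))
    (trans (mmpSegment-smallerLeft a b (L ++ (β ++ ρ)) [] R R-condition) (sym (mmp≡mmpSegment a 0 0 0 R)))
    where
    R-condition : ∀ {v} → v ∈ R → b ≤ #lt v (L ++ (β ++ ρ))
    R-condition {v} v∈ =
      ≤-trans b≤ρ (≤-trans (≤-reflexive (sym (#lt-all v ρ (ρ<L,R (∈-++⁺ʳ L v∈)))))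
        (≤-trans (#lt≤#lt-++ʳ v β ρ) (#lt≤#lt-++ʳ v L (β ++ ρ))))

splits : List A → List (List A × List A)
splits []       = [ ([] , []) ]
splits (x ∷ xs) = map (λ p → (x ∷ proj₁ p , proj₂ p)) (splits xs) ++ map (λ p → (proj₁ p , x ∷ proj₂ p)) (splits xs)

∈-splits⁻ : ∀ (xs : List A) {p} → p ∈ splits xs →
  (∃ λ x → ∃ λ xs′ → ∃ λ q → xs ≡ x ∷ xs′ × q ∈ splits xs′ × p ≡ (x ∷ proj₁ q , proj₂ q)) ⊎
  (∃ λ x → ∃ λ xs′ → ∃ λ q → xs ≡ x ∷ xs′ × q ∈ splits xs′ × p ≡ (proj₁ q , x ∷ proj₂ q)) ⊎
  (xs ≡ [] × p ≡ ([] , []))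
∈-splits⁻ []       (here refl) = inj₂ (inj₂ (refl , refl))
∈-splits⁻ (x ∷ xs) p∈ with ∈-++⁻ (map (λ p → (x ∷ proj₁ p , proj₂ p)) (splits xs)) p∈
... | inj₁ q = let (r , r∈ , e) = ∈-map⁻ _ q in inj₁ (x , xs , r , refl , r∈ , e)
... | inj₂ q = let (r , r∈ , e) = ∈-map⁻ _ q in inj₂ (inj₁ (x , xs , r , refl , r∈ , e))

splits-⊆ : ∀ (xs : List A) {p z} → p ∈ splits xs → (z ∈ proj₁ p → z ∈ xs) × (z ∈ proj₂ p → z ∈ xs)
splits-⊆ xs p∈ with ∈-splits⁻ xs p∈
... | inj₁ (x , xs′ , q , refl , q∈ , refl) =
  (λ { (here e) → here e ; (there r) → there (proj₁ (splits-⊆ xs′ q∈) r) }) ,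
  (λ r → there (proj₂ (splits-⊆ xs′ q∈) r))
... | inj₂ (inj₁ (x , xs′ , q , refl , q∈ , refl)) =
  (λ r → there (proj₁ (splits-⊆ xs′ q∈) r)) ,
  (λ { (here e) → here e ; (there r) → there (proj₂ (splits-⊆ xs′ q∈) r) })
... | inj₂ (inj₂ (refl , refl)) = (λ ()) , (λ ())

splits-length : ∀ (xs : List A) {p} → p ∈ splits xs → length (proj₁ p) + length (proj₂ p) ≡ length xs
splits-length xs p∈ with ∈-splits⁻ xs p∈
... | inj₁ (x , xs′ , q , refl , q∈ , refl) = cong suc (splits-length xs′ q∈)
... | inj₂ (inj₁ (x , xs′ , q , refl , q∈ , refl)) = trans (+-suc _ _) (cong suc (splits-length xs′ q∈))
... | inj₂ (inj₂ (refl , refl)) = refl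

splits-AllPairs : ∀ {R : A → A → Set} (xs : List A) {p} → AllPairs R xs → p ∈ splits xs →
  AllPairs R (proj₁ p) × AllPairs R (proj₂ p)
splits-AllPairs xs ap p∈ with ∈-splits⁻ xs p∈ | ap
... | inj₁ (x , xs′ , q , refl , q∈ , refl) | h ∷ ap′ =
  let (l , r) = splits-AllPairs xs′ ap′ q∈ in All.tabulate (λ z∈ → All.lookup h (proj₁ (splits-⊆ xs′ q∈) z∈)) ∷ l , r
... | inj₂ (inj₁ (x , xs′ , q , refl , q∈ , refl)) | h ∷ ap′ =
  let (l , r) = splits-AllPairs xs′ ap′ q∈ in l , All.tabulate (λ z∈ → All.lookup h (proj₂ (splits-⊆ xs′ q∈) z∈)) ∷ r
... | inj₂ (inj₂ (refl , refl)) | _ = [] , []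

splits-disjoint : ∀ (xs : List A) {p z} → Unique xs → p ∈ splits xs → z ∈ proj₁ p → z ∈ proj₂ p → ⊥
splits-disjoint xs u p∈ z∈₁ z∈₂ with ∈-splits⁻ xs p∈ | u
... | inj₁ (x , xs′ , q , refl , q∈ , refl) | x∉ ∷ u′ with z∈₁
...   | here refl = All.lookup x∉ (proj₂ (splits-⊆ xs′ q∈) z∈₂) refl
...   | there r   = splits-disjoint xs′ u′ q∈ r z∈₂
splits-disjoint xs u p∈ z∈₁ z∈₂ | inj₂ (inj₁ (x , xs′ , q , refl , q∈ , refl)) | x∉ ∷ u′ with z∈₂
...   | here refl = All.lookup x∉ (proj₁ (splits-⊆ xs′ q∈) z∈₁) refl
...   | there r   = splits-disjoint xs′ u′ q∈ z∈₁ r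
splits-disjoint xs u p∈ () z∈₂ | inj₂ (inj₂ (refl , refl)) | _

∈-splits-filter : {P : A → Set} (P? : ∀ x → Dec (P x)) (xs : List A) →
  (filter P? xs , filter (λ x → ¬? (P? x)) xs) ∈ splits xs
∈-splits-filter P? []       = here refl
∈-splits-filter P? (x ∷ xs) with P? x
... | yes _ = ∈-++⁺ˡ (∈-map⁺ _ (∈-splits-filter P? xs))
... | no  _ = ∈-++⁺ʳ (map (λ p → (x ∷ proj₁ p , proj₂ p)) (splits xs)) (∈-map⁺ _ (∈-splits-filter P? xs))

,-≡ : {a c : A} {b d : B} → a ≡ c → b ≡ d → (a , b) ≡ (c , d)
,-≡ refl refl = refl

Unique-splits : ∀ (xs : List A) → Unique xs → Unique (splits xs)
Unique-splits []       _ = [] ∷ []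
Unique-splits (x ∷ xs) u@(_ ∷ u′) = Uniqueₚ.++⁺
  (Uniqueₚ.map⁺ (λ e → ,-≡ (∷-injectiveʳ (cong proj₁ e)) (cong proj₂ e)) (Unique-splits xs u′))
  (Uniqueₚ.map⁺ (λ e → ,-≡ (cong proj₁ e) (∷-injectiveʳ (cong proj₂ e))) (Unique-splits xs u′))
  λ { (p₁ , p₂) → let (q , q∈ , e) = ∈-map⁻ _ p₁ ; (r , r∈ , e′) = ∈-map⁻ _ p₂ in
      Uniqueₚ.Unique[x∷xs]⇒x∉xs u (proj₁ (splits-⊆ xs r∈) (subst (λ w → x ∈ proj₁ w) (trans (sym e) e′) (here refl))) }

splits-determined : ∀ (xs : List A) {p q} → Unique xs → p ∈ splits xs → q ∈ splits xs →
  (∀ {z} → z ∈ proj₁ p → z ∈ proj₁ q) → (∀ {z} → z ∈ proj₁ q → z ∈ proj₁ p) → p ≡ q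
splits-determined [] u (here refl) (here refl) _ _ = refl
splits-determined (x ∷ xs) u@(x∉ ∷ u′) p∈ q∈ f g with ∈-splits⁻ (x ∷ xs) p∈ | ∈-splits⁻ (x ∷ xs) q∈
... | inj₁ (_ , _ , p′ , refl , p′∈ , refl) | inj₁ (_ , _ , q′ , refl , q′∈ , refl) =
  cong (λ w → (x ∷ proj₁ w , proj₂ w))
    (splits-determined xs u′ p′∈ q′∈ (dropHead {q′ = q′} p′∈ f) (dropHead {q′ = p′} q′∈ g))
  where
  dropHead : ∀ {p′ q′} → p′ ∈ splits xs → (∀ {z} → z ∈ x ∷ proj₁ p′ → z ∈ x ∷ proj₁ q′) →
    ∀ {z} → z ∈ proj₁ p′ → z ∈ proj₁ q′
  dropHead p′∈ ff z∈ with ff (there z∈)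
  ... | here refl = ⊥-elim (All.lookup x∉ (proj₁ (splits-⊆ xs p′∈) z∈) refl)
  ... | there r   = r
... | inj₁ (_ , _ , p′ , refl , p′∈ , refl) | inj₂ (inj₁ (_ , _ , q′ , refl , q′∈ , refl)) =
  ⊥-elim (Uniqueₚ.Unique[x∷xs]⇒x∉xs u (proj₁ (splits-⊆ xs q′∈) (f (here refl))))
... | inj₂ (inj₁ (_ , _ , p′ , refl , p′∈ , refl)) | inj₁ (_ , _ , q′ , refl , q′∈ , refl) =
  ⊥-elim (Uniqueₚ.Unique[x∷xs]⇒x∉xs u (proj₁ (splits-⊆ xs p′∈) (g (here refl))))
... | inj₂ (inj₁ (_ , _ , p′ , refl , p′∈ , refl)) | inj₂ (inj₁ (_ , _ , q′ , refl , q′∈ , refl)) =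
  cong (λ w → (proj₁ w , x ∷ proj₂ w)) (splits-determined xs u′ p′∈ q′∈ f g)

∸-suc : ∀ N i → i < N → N ∸ i ≡ suc (N ∸ suc i)
∸-suc (suc N) zero    _         = refl
∸-suc (suc N) (suc i) (s≤s i<N) = ∸-suc N i i<N

sumTo-binomial-shift : ∀ N (h : ℕ → ℕ → ℕ) →
  sumTo N (λ i → (N C i) * h i (suc (N ∸ i))) ≡ h 0 (suc N) + sumTo N (λ i → (N C suc i) * h (suc i) (N ∸ i))
sumTo-binomial-shift N h =
  begin
    sumTo N H
  ≡⟨ sym (+-identityʳ _) ⟩
    sumTo N H + 0
  ≡⟨ cong (λ z → sumTo N H + z * h (suc N) (suc (N ∸ suc N))) (sym (k>n⇒nCk≡0 (n<1+n N))) ⟩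
    sumTo (suc N) H
  ≡⟨ sumTo-suc N H ⟩
    H 0 + sumTo N (λ i → H (suc i))
  ≡⟨ cong₂ _+_ (+-identityʳ (h 0 (suc N))) (sumTo-congᴵⁿ N _ _ shifted) ⟩
    h 0 (suc N) + sumTo N (λ i → (N C suc i) * h (suc i) (N ∸ i))
  ∎
  where
  open ≡-Reasoning
  H = λ i → (N C i) * h i (suc (N ∸ i))
  shifted : ∀ i → i ≤ N → H (suc i) ≡ (N C suc i) * h (suc i) (N ∸ i)
  shifted i i≤N with m≤n⇒m<n∨m≡n i≤N
  ... | inj₁ i<N = cong (λ z → (N C suc i) * h (suc i) z) (sym (∸-suc N i i<N))
  ... | inj₂ refl rewrite k>n⇒nCk≡0 (n<1+n N) = refl

sumTo-pascal : ∀ N (h : ℕ → ℕ → ℕ) →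
  sumTo N (λ i → (N C i) * h (suc i) (N ∸ i)) + sumTo N (λ i → (N C i) * h i (suc (N ∸ i)))
    ≡ sumTo (suc N) (λ i → (suc N C i) * h i (suc N ∸ i))
sumTo-pascal N h =
  begin
    Σ₁ + sumTo N (λ i → (N C i) * h i (suc (N ∸ i)))
  ≡⟨ cong (Σ₁ +_) (sumTo-binomial-shift N h) ⟩
    Σ₁ + (h 0 (suc N) + Σ₂)
  ≡⟨ +-comm-middle Σ₁ (h 0 (suc N)) Σ₂ ⟩
    h 0 (suc N) + (Σ₁ + Σ₂)
  ≡⟨ cong (h 0 (suc N) +_) (sym (sumTo-+ N _ _)) ⟩
    h 0 (suc N) + sumTo N (λ i → (N C i) * h (suc i) (N ∸ i) + (N C suc i) * h (suc i) (N ∸ i))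
  ≡⟨ cong (h 0 (suc N) +_) (sumTo-cong N (λ i → trans (sym (*-distribʳ-+ (h (suc i) (N ∸ i)) (N C i) (N C suc i)))
                                                    (cong (_* h (suc i) (N ∸ i)) (nCk+nC[k+1]≡[n+1]C[k+1] N i)))) ⟩
    h 0 (suc N) + sumTo N (λ i → (suc N C suc i) * h (suc i) (N ∸ i))
  ≡⟨ cong (_+ sumTo N (λ i → (suc N C suc i) * h (suc i) (N ∸ i))) (sym (+-identityʳ (h 0 (suc N)))) ⟩
    (suc N C 0) * h 0 (suc N) + sumTo N (λ i → (suc N C suc i) * h (suc i) (suc N ∸ suc i))
  ≡⟨ sym (sumTo-suc N (λ i → (suc N C i) * h i (suc N ∸ i))) ⟩
    sumTo (suc N) (λ i → (suc N C i) * h i (suc N ∸ i))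
  ∎
  where
  open ≡-Reasoning
  Σ₁ = sumTo N (λ i → (N C i) * h (suc i) (N ∸ i))
  Σ₂ = sumTo N (λ i → (N C suc i) * h (suc i) (N ∸ i))
  +-comm-middle : ∀ a c b → a + (c + b) ≡ c + (a + b)
  +-comm-middle = solve-∀

sum-splits : {A : Set} (g : ℕ → ℕ → ℕ) (xs : List A) →
  sum (map (λ p → g (length (proj₁ p)) (length (proj₂ p))) (splits xs))
    ≡ sumTo (length xs) (λ i → (length xs C i) * g i (length xs ∸ i))
sum-splits g []       = refl
sum-splits {A} g (x ∷ xs) =
  begin
    sum (map G (map toLeft S ++ map toRight S))
  ≡⟨ cong sum (map-++ G (map toLeft S) (map toRight S)) ⟩
    sum (map G (map toLeft S) ++ map G (map toRight S))
  ≡⟨ sum-++ (map G (map toLeft S)) (map G (map toRight S)) ⟩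
    sum (map G (map toLeft S)) + sum (map G (map toRight S))
  ≡⟨ cong₂ _+_ (trans (cong sum (sym (map-∘ S))) (sum-splits (λ i j → g (suc i) j) xs))
               (trans (cong sum (sym (map-∘ S))) (sum-splits (λ i j → g i (suc j)) xs)) ⟩
    sumTo N (λ i → (N C i) * g (suc i) (N ∸ i)) + sumTo N (λ i → (N C i) * g i (suc (N ∸ i)))
  ≡⟨ sumTo-pascal N g ⟩
    sumTo (suc N) (λ i → (suc N C i) * g i (suc N ∸ i))
  ∎
  where
  open ≡-Reasoning
  N = length xs
  S = splits xs
  G = λ (p : List A × List A) → g (length (proj₁ p)) (length (proj₂ p))
  toLeft = λ (p : List A × List A) → (x ∷ proj₁ p , proj₂ p)
  toRight = λ (p : List A × List A) → (proj₁ p , x ∷ proj₂ p)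

-- Permutations containing the block βα

≡⇒≡ᵇ≡true : ∀ {x y} → x ≡ y → (x ≡ᵇ y) ≡ true
≡⇒≡ᵇ≡true {x} {y} e with x ≡ᵇ y in eq
... | true  = refl
... | false = ⊥-elim (subst T eq (≡⇒≡ᵇ x y e))

≡ᵇ≡true⇒≡ : ∀ {x y} → (x ≡ᵇ y) ≡ true → x ≡ y
≡ᵇ≡true⇒≡ {x} {y} e = ≡ᵇ⇒≡ x y (subst T (sym e) tt)

≢⇒≡ᵇ≡false : ∀ {x y} → x ≢ y → (x ≡ᵇ y) ≡ false
≢⇒≡ᵇ≡false {x} {y} x≢y with x ≡ᵇ y in eq
... | true  = ⊥-elim (x≢y (≡ᵇ≡true⇒≡ eq))
... | false = refl

length-filter-∧-≡ᵇ : (P : List ℕ → Bool) (f : List ℕ → ℕ) (m : ℕ) (σs : List (List ℕ)) →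
  length (filter (λ σ → (P σ ∧ (f σ ≡ᵇ m)) 𝔹.≟ true) σs) ≡ count f (filter (λ σ → P σ 𝔹.≟ true) σs) m
length-filter-∧-≡ᵇ P f m []       = refl
length-filter-∧-≡ᵇ P f m (σ ∷ σs) with P σ
... | false = length-filter-∧-≡ᵇ P f m σs
... | true with f σ ≟ m
...   | yes e  rewrite ≡⇒≡ᵇ≡true e  = cong suc (length-filter-∧-≡ᵇ P f m σs)
...   | no ¬e rewrite ≢⇒≡ᵇ≡false ¬e = length-filter-∧-≡ᵇ P f m σs

isPrefix-++ : ∀ w R → isPrefix w (w ++ R) ≡ true
isPrefix-++ []      R = refl
isPrefix-++ (x ∷ w) R rewrite ≡⇒≡ᵇ≡true {x} {x} refl = isPrefix-++ w R

isPrefix⇒++ : ∀ w u → isPrefix w u ≡ true → ∃ λ R → u ≡ w ++ R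
isPrefix⇒++ []      u       _ = u , refl
isPrefix⇒++ (x ∷ w) (y ∷ u) e with x ≡ᵇ y in x≡ᵇy
... | true with isPrefix⇒++ w u e
...   | R , refl = R , cong (_∷ (w ++ R)) (sym (≡ᵇ≡true⇒≡ x≡ᵇy))

containsBlock-middle : ∀ L w R → containsBlock w (L ++ w ++ R) ≡ true
containsBlock-middle []      []      [] = refl
containsBlock-middle []      []      (y ∷ R) = refl
containsBlock-middle []      (x ∷ w) R rewrite isPrefix-++ (x ∷ w) R = refl
containsBlock-middle (x ∷ L) w       R rewrite containsBlock-middle L w R = ∨-zeroʳ _

containsBlock⇒middle : ∀ w u → containsBlock w u ≡ true → ∃₂ λ L R → u ≡ L ++ w ++ R
containsBlock⇒middle w [] e with isPrefix⇒++ w [] e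
... | R , eq with w | R
... | [] | [] = [] , [] , refl
containsBlock⇒middle w (y ∷ u) e with isPrefix w (y ∷ u) in pre
... | true  = let (R , eq) = isPrefix⇒++ w (y ∷ u) pre in [] , R , eq
... | false with containsBlock⇒middle w u e
...   | L , R , refl = y ∷ L , R , refl

module BlockPermutations (k ℓ n : ℕ) (τ ρ : List ℕ) (1≤k : 1 ≤ k) (τ∈ : τ ∈ Sym k) (ρ∈ : ρ ∈ Sym ℓ)
                         (k+ℓ≤n : k + ℓ ≤ n) where

  N = n ∸ k ∸ ℓ
  s = n ∸ k
  β = map (_+ s) τ
  βα = blockβα n k τ ρ

  -- the values ℓ+1 .. n−k, which fill the positions outside the block
  middle : List ℕ
  middle = map (_+ ℓ) (oneTo N)

  k≤n : k ≤ n
  k≤n = ≤-trans (m≤m+n k ℓ) k+ℓ≤n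

  ℓ≤s : ℓ ≤ s
  ℓ≤s = m+n≤o⇒m≤o∸n ℓ (subst (_≤ n) (+-comm k ℓ) k+ℓ≤n)

  N+ℓ≡s : N + ℓ ≡ s
  N+ℓ≡s = m∸n+n≡m ℓ≤s

  s+k≡n : s + k ≡ n
  s+k≡n = m∸n+n≡m k≤n

  τ-perm = ∈-Sym⁻ k τ∈
  ρ-perm = ∈-Sym⁻ ℓ ρ∈

  ∈τ⇒ : ∀ {y} → y ∈ τ → 1 ≤ y × y ≤ k
  ∈τ⇒ y∈ = ∈-oneTo⁻ k (All.lookup (proj₁ (proj₂ τ-perm)) y∈)

  ∈ρ⇒ : ∀ {y} → y ∈ ρ → 1 ≤ y × y ≤ ℓ
  ∈ρ⇒ y∈ = ∈-oneTo⁻ ℓ (All.lookup (proj₁ (proj₂ ρ-perm)) y∈)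

  ∈β⇒ : ∀ {y} → y ∈ β → s < y × y ≤ n
  ∈β⇒ y∈ with ∈-map⁻ (_+ s) y∈
  ... | u , u∈ , refl = let (1≤u , u≤k) = ∈τ⇒ u∈ in
    +-monoˡ-≤ s 1≤u , subst (u + s ≤_) (trans (+-comm k s) s+k≡n) (+-monoˡ-≤ s u≤k)

  ∈βα⇒ : ∀ {y} → y ∈ βα → (s < y × y ≤ n) ⊎ (1 ≤ y × y ≤ ℓ)
  ∈βα⇒ y∈ with ∈-++⁻ β y∈
  ... | inj₁ p = inj₁ (∈β⇒ p)
  ... | inj₂ p = inj₂ (∈ρ⇒ p)

  length-βα : length βα ≡ k + ℓ
  length-βα = trans (length-++ β) (cong₂ _+_ (trans (length-map _ τ) (proj₁ τ-perm)) (proj₁ ρ-perm))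

  Unique-βα : Unique βα
  Unique-βα = Uniqueₚ.++⁺ (Uniqueₚ.map⁺ (λ {x} {y} → +-cancelʳ-≡ s x y) (proj₂ (proj₂ τ-perm))) (proj₂ (proj₂ ρ-perm))
    λ { (p , q) → <-irrefl refl (≤-<-trans (≤-trans (proj₂ (∈ρ⇒ q)) ℓ≤s) (proj₁ (∈β⇒ p))) }

  middle∉βα : ∀ {z} → ℓ < z → z ≤ s → z ∉ βα
  middle∉βα ℓ<z z≤s z∈ with ∈βα⇒ z∈
  ... | inj₁ (s<z , _) = <-irrefl refl (<-≤-trans s<z z≤s)
  ... | inj₂ (_ , z≤ℓ) = <-irrefl refl (<-≤-trans ℓ<z z≤ℓ)

  ∉βα⇒middle : ∀ {z} → 1 ≤ z → z ≤ n → z ∉ βα → ℓ < z × z ≤ s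
  ∉βα⇒middle {z} 1≤z z≤n′ z∉ with ℓ <? z | z ≤? s
  ... | yes ℓ<z | yes z≤s = ℓ<z , z≤s
  ... | no ℓ≮z | _ =
    ⊥-elim (z∉ (∈-++⁺ʳ β (∈-resp-↭ (↭-sym (IsPermutation⇒↭ ℓ ρ-perm)) (∈-oneTo⁺ ℓ 1≤z (≮⇒≥ ℓ≮z)))))
  ... | yes _ | no z≰s = ⊥-elim (z∉ (∈-++⁺ˡ (subst (_∈ β) (m∸n+n≡m (<⇒≤ (≰⇒> z≰s)))
        (∈-map⁺ (_+ s) (∈-resp-↭ (↭-sym (IsPermutation⇒↭ k τ-perm))
          (∈-oneTo⁺ k (m<n⇒0<n∸m (≰⇒> z≰s)) (≤-trans (∸-monoˡ-≤ s z≤n′) (≤-reflexive (m∸[m∸n]≡n k≤n)))))))))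

  ∈-middle⁻ : ∀ {v} → v ∈ middle → ℓ < v × v ≤ s
  ∈-middle⁻ v∈ with ∈-map⁻ (_+ ℓ) v∈
  ... | u , u∈ , refl = let (1≤u , u≤N) = ∈-oneTo⁻ N u∈ in
    +-monoˡ-≤ ℓ 1≤u , subst (u + ℓ ≤_) N+ℓ≡s (+-monoˡ-≤ ℓ u≤N)

  ∈-middle⁺ : ∀ {v} → ℓ < v → v ≤ s → v ∈ middle
  ∈-middle⁺ {v} ℓ<v v≤s = subst (_∈ middle) (m∸n+n≡m (<⇒≤ ℓ<v))
    (∈-map⁺ (_+ ℓ) (∈-oneTo⁺ N (m<n⇒0<n∸m ℓ<v)
      (subst (v ∸ ℓ ≤_) (trans (cong (_∸ ℓ) (sym N+ℓ≡s)) (m+n∸n≡m N ℓ)) (∸-monoˡ-≤ ℓ v≤s))))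

  ∈-middle-oneTo : ∀ {z} → ℓ < z → z ≤ s → z ∈ oneTo n
  ∈-middle-oneTo ℓ<z z≤s = ∈-oneTo⁺ n (≤-trans (s≤s z≤n) ℓ<z) (≤-trans z≤s (m∸n≤m n k))

  Increasing-middle : Increasing middle
  Increasing-middle = AllPairsₚ.map⁺ (AllPairs.map (+-monoˡ-< ℓ) (Increasing-oneTo N))

  Unique-middle : Unique middle
  Unique-middle = Increasing⇒Unique Increasing-middle

  length-middle : length middle ≡ N
  length-middle = trans (length-map _ (oneTo N)) (length-oneTo N)

  -- Choose which middle values go left of the block, then arrange both sides.
  arrangementsOf : List ℕ × List ℕ → List (List ℕ × List ℕ)
  arrangementsOf sc = cartesianProduct (permutations (proj₁ sc)) (permutations (proj₂ sc))

  arrangements : List (List ℕ × List ℕ)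
  arrangements = concatMap arrangementsOf (splits middle)

  assemble : List ℕ × List ℕ → List ℕ
  assemble (L , R) = L ++ βα ++ R

  ∈-arrangements⁻ : ∀ {p} → p ∈ arrangements →
    ∃ λ sc → sc ∈ splits middle × proj₁ p ↭ proj₁ sc × proj₂ p ↭ proj₂ sc
  ∈-arrangements⁻ p∈ with ∈-concatMap⁻′ arrangementsOf (splits middle) p∈
  ... | sc , sc∈ , q with ∈-cartesianProduct⁻ (permutations (proj₁ sc)) (permutations (proj₂ sc)) q
  ... | l∈ , r∈ = sc , sc∈ , ∈-permutations⁻ _ l∈ , ∈-permutations⁻ _ r∈

  Increasing-splits : ∀ {sc} → sc ∈ splits middle → Increasing (proj₁ sc) × Increasing (proj₂ sc)
  Increasing-splits = splits-AllPairs middle Increasing-middle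

  arrangement-middle : ∀ {p z} → p ∈ arrangements → z ∈ proj₁ p ++ proj₂ p → ℓ < z × z ≤ s
  arrangement-middle {p} p∈ z∈ with ∈-arrangements⁻ p∈
  ... | sc , sc∈ , l↭ , r↭ with ∈-++⁻ (proj₁ p) z∈
  ... | inj₁ q = ∈-middle⁻ (proj₁ (splits-⊆ middle sc∈) (∈-resp-↭ l↭ q))
  ... | inj₂ q = ∈-middle⁻ (proj₂ (splits-⊆ middle sc∈) (∈-resp-↭ r↭ q))

  assemble-sound : ∀ {p} → p ∈ arrangements → IsPermutation n (assemble p) × containsBlock βα (assemble p) ≡ true
  assemble-sound {L , R} p∈ with ∈-arrangements⁻ p∈
  ... | (l , r) , sc∈ , L↭ , R↭ = (length-assembled , values , unique) , containsBlock-middle L βα R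
    where
    middle-of : ∀ {z} → z ∈ L ++ R → ℓ < z × z ≤ s
    middle-of = arrangement-middle p∈
    length-L+R : length L + length R ≡ N
    length-L+R = trans (cong₂ _+_ (↭-length L↭) (↭-length R↭)) (trans (splits-length middle sc∈) length-middle)
    length-assembled : length (L ++ βα ++ R) ≡ n
    length-assembled =
      begin
        length (L ++ βα ++ R)
      ≡⟨ trans (length-++ L) (cong (length L +_) (trans (length-++ βα) (cong (_+ length R) length-βα))) ⟩
        length L + (k + ℓ + length R)
      ≡⟨ rearrange (length L) (length R) k ℓ ⟩
        (length L + length R) + ℓ + k
      ≡⟨ cong (λ x → x + ℓ + k) length-L+R ⟩
        N + ℓ + k
      ≡⟨ cong (_+ k) N+ℓ≡s ⟩
        s + k
      ≡⟨ s+k≡n ⟩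
        n
      ∎
      where
      open ≡-Reasoning
      rearrange : ∀ x y k ℓ → x + (k + ℓ + y) ≡ (x + y) + ℓ + k
      rearrange = solve-∀
    values : All (_∈ oneTo n) (L ++ βα ++ R)
    values = All.tabulate value
      where
      value : ∀ {z} → z ∈ L ++ βα ++ R → z ∈ oneTo n
      value z∈ with ∈-++⁻ L z∈
      ... | inj₁ q = let (ℓ<z , z≤s) = middle-of (∈-++⁺ˡ q) in ∈-middle-oneTo ℓ<z z≤s
      ... | inj₂ q with ∈-++⁻ βα q
      ...   | inj₂ r = let (ℓ<z , z≤s) = middle-of (∈-++⁺ʳ L r) in ∈-middle-oneTo ℓ<z z≤s
      ...   | inj₁ r with ∈βα⇒ r
      ...     | inj₁ (s<z , z≤n′) = ∈-oneTo⁺ n (≤-trans (s≤s z≤n) s<z) z≤n′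
      ...     | inj₂ (1≤z , z≤ℓ) = ∈-oneTo⁺ n 1≤z (≤-trans z≤ℓ (≤-trans ℓ≤s (m∸n≤m n k)))
    βα∩R : ∀ {z} → z ∈ βα → z ∈ R → ⊥
    βα∩R q r = let (ℓ<z , z≤s) = middle-of (∈-++⁺ʳ L r) in middle∉βα ℓ<z z≤s q
    L∩βα++R : ∀ {z} → z ∈ L → z ∈ βα ++ R → ⊥
    L∩βα++R q r with ∈-++⁻ βα r
    ... | inj₁ r′ = let (ℓ<z , z≤s) = middle-of (∈-++⁺ˡ q) in middle∉βα ℓ<z z≤s r′
    ... | inj₂ r′ = splits-disjoint middle Unique-middle sc∈ (∈-resp-↭ L↭ q) (∈-resp-↭ R↭ r′)
    unique : Unique (L ++ βα ++ R)
    unique = Uniqueₚ.++⁺ (Unique-resp-↭ (↭-sym L↭) (Increasing⇒Unique (proj₁ (Increasing-splits sc∈))))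
      (Uniqueₚ.++⁺ Unique-βα (Unique-resp-↭ (↭-sym R↭) (Increasing⇒Unique (proj₂ (Increasing-splits sc∈))))
        λ { (q , r) → βα∩R q r })
      λ { (q , r) → L∩βα++R q r }

  assemble-complete : ∀ {σ} → σ ∈ Sym n → containsBlock βα σ ≡ true → σ ∈ map assemble arrangements
  assemble-complete {σ} σ∈ cb with containsBlock⇒middle βα σ cb
  ... | L , R , refl =
    ∈-map⁺ assemble (∈-concatMap⁺′ arrangementsOf (∈-splits-filter (_∈? L) middle)
      (∈-cartesianProduct⁺ (∈-permutations⁺ _ L↭) (∈-permutations⁺ _ R↭)))
    where
    σ-perm = ∈-Sym⁻ n σ∈
    σ↭ = IsPermutation⇒↭ n σ-perm
    split₁ = Unique-++⁻ {xs = L} {ys = βα ++ R} (proj₂ (proj₂ σ-perm))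
    split₂ = Unique-++⁻ {xs = βα} {ys = R} (proj₁ (proj₂ split₁))
    L∩βα++R = proj₂ (proj₂ split₁)
    βα∩R = proj₂ (proj₂ split₂)
    middle-of : ∀ {z} → z ∈ L ++ βα ++ R → z ∉ βα → ℓ < z × z ≤ s
    middle-of z∈ z∉ =
      let (1≤z , z≤n′) = ∈-oneTo⁻ n (All.lookup (proj₁ (proj₂ σ-perm)) z∈) in ∉βα⇒middle 1≤z z≤n′ z∉
    ∉L? = λ z → ¬? (z ∈? L)
    L↭ : L ↭ filter (_∈? L) middle
    L↭ = unique∧sameElements⇒↭ (proj₁ split₁) (Uniqueₚ.filter⁺ (_∈? L) Unique-middle)
      (λ z∈ → ∈-filter⁺ (_∈? L)
        (let (ℓ<z , z≤s) = middle-of (∈-++⁺ˡ z∈) (λ q → L∩βα++R z∈ (∈-++⁺ˡ q)) in ∈-middle⁺ ℓ<z z≤s) z∈)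
      (λ z∈ → proj₂ (∈-filter⁻ (_∈? L) {xs = middle} z∈))
    R⊇ : ∀ {z} → z ∈ filter ∉L? middle → z ∈ R
    R⊇ z∈ with ∈-filter⁻ ∉L? z∈
    ... | z∈middle , z∉L with ∈-middle⁻ z∈middle
    ... | ℓ<z , z≤s with ∈-++⁻ L (∈-resp-↭ (↭-sym σ↭) (∈-middle-oneTo ℓ<z z≤s))
    ...   | inj₁ q = ⊥-elim (z∉L q)
    ...   | inj₂ q with ∈-++⁻ βα q
    ...     | inj₁ r = ⊥-elim (middle∉βα ℓ<z z≤s r)
    ...     | inj₂ r = r
    R↭ : R ↭ filter ∉L? middle
    R↭ = unique∧sameElements⇒↭ (proj₁ (proj₂ split₂)) (Uniqueₚ.filter⁺ ∉L? Unique-middle)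
      (λ z∈ → ∈-filter⁺ ∉L?
        (let (ℓ<z , z≤s) = middle-of (∈-++⁺ʳ L (∈-++⁺ʳ βα z∈)) (λ q → βα∩R q z∈) in ∈-middle⁺ ℓ<z z≤s)
        (λ q → L∩βα++R q (∈-++⁺ʳ βα z∈)))
      R⊇

  Unique-arrangements : Unique arrangements
  Unique-arrangements = Unique-concatMap⁺ arrangementsOf (Unique-splits middle Unique-middle)
    (λ sc∈ → Uniqueₚ.cartesianProduct⁺ (Unique-permutations _ (Increasing⇒Unique (proj₁ (Increasing-splits sc∈))))
                                        (Unique-permutations _ (Increasing⇒Unique (proj₂ (Increasing-splits sc∈)))))
    λ {sc₁} {sc₂} i₁ i₂ z₁ z₂ →
      let (l₁ , _) = ∈-cartesianProduct⁻ (permutations (proj₁ sc₁)) (permutations (proj₂ sc₁)) z₁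
          (l₂ , _) = ∈-cartesianProduct⁻ (permutations (proj₁ sc₂)) (permutations (proj₂ sc₂)) z₂
          e₁ = ∈-permutations⁻ _ l₁
          e₂ = ∈-permutations⁻ _ l₂
      in splits-determined middle Unique-middle i₁ i₂
           (λ w∈ → ∈-resp-↭ e₂ (∈-resp-↭ (↭-sym e₁) w∈))
           (λ w∈ → ∈-resp-↭ e₁ (∈-resp-↭ (↭-sym e₂) w∈))

  assemble-injective : ∀ {p q} → p ∈ arrangements → q ∈ arrangements → assemble p ≡ assemble q → p ≡ q
  assemble-injective {L , R} {L′ , R′} p∈ q∈ e
    with ++-cancel-block βα (disjoint p∈) (disjoint q∈) (subst (0 <_) (sym length-βα) (≤-trans 1≤k (m≤m+n k ℓ))) e
    where
    disjoint : ∀ {L R} → (L , R) ∈ arrangements → ∀ {z} → z ∈ L → z ∈ βα → ⊥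
    disjoint p∈ z∈ = let (ℓ<z , z≤s) = arrangement-middle p∈ (∈-++⁺ˡ z∈) in middle∉βα ℓ<z z≤s
  ... | refl , refl = refl

  assembled↭filter : map assemble arrangements ↭ filter (λ σ → containsBlock βα σ 𝔹.≟ true) (Sym n)
  assembled↭filter =
    unique∧sameElements⇒↭ (Unique-map⁺-injectiveOn assemble Unique-arrangements assemble-injective)
      (Uniqueₚ.filter⁺ _ (Unique-Sym n))
      (λ σ∈ → let (p , p∈ , σ≡) = ∈-map⁻ assemble σ∈ ; (perm , cb) = assemble-sound p∈ in
        subst (_∈ _) (sym σ≡) (∈-filter⁺ (λ σ → containsBlock βα σ 𝔹.≟ true) (∈-Sym⁺ n perm) cb))
      (λ σ∈ → let (σ∈Sym , cb) = ∈-filter⁻ (λ σ → containsBlock βα σ 𝔹.≟ true) {xs = Sym n} σ∈ in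
        assemble-complete σ∈Sym cb)

  module _ (a b : ℕ) (τ-avoids : mmp a 0 0 0 τ ≡ 0) (ρ-avoids : mmp 0 0 b 0 ρ ≡ 0) (a≤k : a ≤ k) (b≤ℓ : b ≤ ℓ) where

    mmp-assemble : ∀ {p} → p ∈ arrangements → mmp a 0 b 0 (assemble p) ≡ mmp 0 0 b 0 (proj₁ p) + mmp a 0 0 0 (proj₂ p)
    mmp-assemble {L , R} p∈ = mmp-block-split a b L R τ ρ s τ-avoids ρ-avoids
      (subst (a ≤_) (sym (proj₁ τ-perm)) a≤k) (subst (b ≤_) (sym (proj₁ ρ-perm)) b≤ℓ)
      (λ v∈ y∈ → <-≤-trans (s≤s (proj₂ (arrangement-middle p∈ v∈))) (+-monoˡ-≤ s (proj₁ (∈τ⇒ y∈))))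
      (λ v∈ y∈ → ≤-<-trans (proj₂ (∈ρ⇒ y∈)) (proj₁ (arrangement-middle p∈ v∈)))
      (λ v∈ y∈ → <-≤-trans (s≤s (≤-trans (proj₂ (∈ρ⇒ v∈)) ℓ≤s)) (+-monoˡ-≤ s (proj₁ (∈τ⇒ y∈))))

    RbarCoeff-convolution : ∀ m →
      RbarCoeff a 0 b 0 k τ ρ n m ≡ sumTo N (λ i → (N C i) * convCoeff (Rcoeff 0 0 b 0 i) (Rcoeff a 0 0 0 (N ∸ i)) m)
    RbarCoeff-convolution m =
      begin
        RbarCoeff a 0 b 0 k τ ρ n m
      ≡⟨ length-filter-∧-≡ᵇ (containsBlock βα) st m (Sym n) ⟩
        count st (filter (λ σ → containsBlock βα σ 𝔹.≟ true) (Sym n)) m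
      ≡⟨ count-↭ st m (↭-sym assembled↭filter) ⟩
        count st (map assemble arrangements) m
      ≡⟨ count-map st assemble arrangements m ⟩
        count (λ p → st (assemble p)) arrangements m
      ≡⟨ count-congᴵⁿ _ F arrangements m mmp-assemble ⟩
        count F arrangements m
      ≡⟨ count-concatMap F arrangementsOf (splits middle) m ⟩
        sum (map (λ sc → count F (arrangementsOf sc) m) (splits middle))
      ≡⟨ cong sum (map-cong-local (All.tabulate count-arrangementsOf)) ⟩
        sum (map (λ sc → convCoeff (Rcoeff 0 0 b 0 (length (proj₁ sc))) (Rcoeff a 0 0 0 (length (proj₂ sc))) m) (splits middle))
      ≡⟨ sum-splits (λ i j → convCoeff (Rcoeff 0 0 b 0 i) (Rcoeff a 0 0 0 j) m) middle ⟩
        sumTo (length middle) (λ i → (length middle C i) * convCoeff (Rcoeff 0 0 b 0 i) (Rcoeff a 0 0 0 (length middle ∸ i)) m)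
      ≡⟨ cong (λ z → sumTo z (λ i → (z C i) * convCoeff (Rcoeff 0 0 b 0 i) (Rcoeff a 0 0 0 (z ∸ i)) m)) length-middle ⟩
        sumTo N (λ i → (N C i) * convCoeff (Rcoeff 0 0 b 0 i) (Rcoeff a 0 0 0 (N ∸ i)) m)
      ∎
      where
      open ≡-Reasoning
      st = mmp a 0 b 0
      F : List ℕ × List ℕ → ℕ
      F (L , R) = mmp 0 0 b 0 L + mmp a 0 0 0 R
      count-arrangementsOf : ∀ {sc} → sc ∈ splits middle →
        count F (arrangementsOf sc) m ≡ convCoeff (Rcoeff 0 0 b 0 (length (proj₁ sc))) (Rcoeff a 0 0 0 (length (proj₂ sc))) m
      count-arrangementsOf {sc} sc∈ =
        trans (count-cartesianProduct (mmp 0 0 b 0) (mmp a 0 0 0) (permutations (proj₁ sc)) (permutations (proj₂ sc)) m)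
          (convCoeff-cong m (count-mmp-permutations 0 0 b 0 (proj₁ (Increasing-splits sc∈)))
                            (count-mmp-permutations a 0 0 0 (proj₂ (Increasing-splits sc∈))))

-- Inserting a new minimum or maximum

mmpGo-a000-prefix : ∀ a pre pre′ xs → mmpGo a 0 0 0 pre xs ≡ mmpGo a 0 0 0 pre′ xs
mmpGo-a000-prefix a pre pre′ []       = refl
mmpGo-a000-prefix a pre pre′ (v ∷ xs) =
  cong ((if (a ≤ᵇ #gt v xs) ∧ true then 1 else 0) +_) (mmpGo-a000-prefix a (pre ++ [ v ]) (pre′ ++ [ v ]) xs)

mmpGo-0010-cong : ∀ P P′ xs → (∀ {v} → v ∈ xs → #lt v P ≡ #lt v P′) → mmpGo 0 0 1 0 P xs ≡ mmpGo 0 0 1 0 P′ xs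
mmpGo-0010-cong P P′ []       h = refl
mmpGo-0010-cong P P′ (v ∷ xs) h =
  cong₂ _+_ (cong (λ z → if (1 ≤ᵇ z) ∧ true then 1 else 0) (h (here refl)))
    (mmpGo-0010-cong (P ++ [ v ]) (P′ ++ [ v ]) xs (λ {u} u∈ →
      trans (#lt-++ u P [ v ]) (trans (cong (_+ #lt u [ v ]) (h (there u∈))) (sym (#lt-++ u P′ [ v ])))))

#gt-insert-smaller : ∀ y u (a b : List ℕ) → ¬ (y < u) → #gt y (a ++ u ∷ b) ≡ #gt y (a ++ b)
#gt-insert-smaller y u []      b y≮u = cong length (filter-reject (y <?_) y≮u)
#gt-insert-smaller y u (x ∷ a) b y≮u with y <? x
... | yes y<x = trans (cong length (filter-accept (y <?_) y<x))
                  (trans (cong suc (#gt-insert-smaller y u a b y≮u)) (sym (cong length (filter-accept (y <?_) y<x))))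
... | no  y≮x = trans (cong length (filter-reject (y <?_) y≮x))
                  (trans (#gt-insert-smaller y u a b y≮u) (sym (cong length (filter-reject (y <?_) y≮x))))

mmp1000-insertions-min : ∀ u pre ys → (∀ {z} → z ∈ ys → u < z) →
  map (mmpGo 1 0 0 0 pre) (insertions u ys)
    ≡ replicate (length ys) (suc (mmpGo 1 0 0 0 pre ys)) ++ [ mmpGo 1 0 0 0 pre ys ]
mmp1000-insertions-min u pre []       h = refl
mmp1000-insertions-min u pre (y ∷ ys) h = cong₂ _∷_ first rest
  where
  c = if (1 ≤ᵇ #gt y ys) ∧ true then 1 else 0
  G = mmpGo 1 0 0 0 (pre ++ [ y ]) ys
  first : mmpGo 1 0 0 0 pre (u ∷ y ∷ ys) ≡ suc (mmpGo 1 0 0 0 pre (y ∷ ys))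
  first rewrite ≤⇒≤ᵇ≡true {1} {#gt u (y ∷ ys)}
                  (≤-trans (s≤s z≤n) (≤-reflexive (sym (cong length (filter-accept (u <?_) {xs = ys} (h (here refl))))))) =
    cong suc (mmpGo-a000-prefix 1 (pre ++ [ u ]) pre (y ∷ ys))
  afterHead : ∀ {σ} → σ ∈ insertions u ys → mmpGo 1 0 0 0 pre (y ∷ σ) ≡ c + mmpGo 1 0 0 0 (pre ++ [ y ]) σ
  afterHead σ∈ with ∈-insertions⁻ u ys σ∈
  ... | a , b , refl , refl rewrite #gt-insert-smaller y u a b (λ lt → <-asym lt (h (here refl))) = refl
  rest : map (mmpGo 1 0 0 0 pre) (map (y ∷_) (insertions u ys))
           ≡ replicate (length ys) (suc (mmpGo 1 0 0 0 pre (y ∷ ys))) ++ [ mmpGo 1 0 0 0 pre (y ∷ ys) ]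
  rest =
    begin
      map (mmpGo 1 0 0 0 pre) (map (y ∷_) (insertions u ys))
    ≡⟨ sym (map-∘ (insertions u ys)) ⟩
      map (λ σ → mmpGo 1 0 0 0 pre (y ∷ σ)) (insertions u ys)
    ≡⟨ map-cong-local (All.tabulate afterHead) ⟩
      map (λ σ → c + mmpGo 1 0 0 0 (pre ++ [ y ]) σ) (insertions u ys)
    ≡⟨ map-∘ (insertions u ys) ⟩
      map (c +_) (map (mmpGo 1 0 0 0 (pre ++ [ y ])) (insertions u ys))
    ≡⟨ cong (map (c +_)) (mmp1000-insertions-min u (pre ++ [ y ]) ys (λ q → h (there q))) ⟩
      map (c +_) (replicate (length ys) (suc G) ++ [ G ])
    ≡⟨ map-++ (c +_) (replicate (length ys) (suc G)) [ G ] ⟩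
      map (c +_) (replicate (length ys) (suc G)) ++ [ c + G ]
    ≡⟨ cong (_++ [ c + G ]) (trans (map-replicate (c +_) (length ys) (suc G)) (cong (replicate (length ys)) (+-suc c G))) ⟩
      replicate (length ys) (suc (c + G)) ++ [ c + G ]
    ∎
    where open ≡-Reasoning

mmp0010-insertions-max : ∀ w pre ys → (∀ {z} → z ∈ pre → z < w) → (∀ {z} → z ∈ ys → z < w) →
  map (mmpGo 0 0 1 0 pre) (insertions w ys)
    ≡ ((if (1 ≤ᵇ #lt w pre) ∧ true then 1 else 0) + mmpGo 0 0 1 0 pre ys) ∷ replicate (length ys) (suc (mmpGo 0 0 1 0 pre ys))
mmp0010-insertions-max w pre []       hp hy = refl
mmp0010-insertions-max w pre (y ∷ ys) hp hy = cong₂ _∷_ first rest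
  where
  e = if (1 ≤ᵇ #lt w pre) ∧ true then 1 else 0
  c = if (1 ≤ᵇ #lt y pre) ∧ true then 1 else 0
  G = mmpGo 0 0 1 0 (pre ++ [ y ]) ys
  w-invisible : ∀ {v} → v ∈ y ∷ ys → #lt v (pre ++ [ w ]) ≡ #lt v pre
  w-invisible {v} v∈ = trans (#lt-++ v pre [ w ])
    (trans (cong (#lt v pre +_) (cong length (filter-reject (_<? v) (λ lt → <-asym lt (hy v∈))))) (+-identityʳ _))
  first : mmpGo 0 0 1 0 pre (w ∷ y ∷ ys) ≡ e + mmpGo 0 0 1 0 pre (y ∷ ys)
  first = cong (e +_) (mmpGo-0010-cong (pre ++ [ w ]) pre (y ∷ ys) w-invisible)
  y-before-w : (1 ≤ᵇ #lt w (pre ++ [ y ])) ≡ true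
  y-before-w = ≤⇒≤ᵇ≡true (≤-trans (≤-reflexive (sym (cong length (filter-accept (_<? w) {xs = []} (hy (here refl))))))
                 (≤-trans (m≤n+m _ (#lt w pre)) (≤-reflexive (sym (#lt-++ w pre [ y ])))))
  pre′<w : ∀ {z} → z ∈ pre ++ [ y ] → z < w
  pre′<w q with ∈-++⁻ pre q
  ... | inj₁ r         = hp r
  ... | inj₂ (here refl) = hy (here refl)
  rest : map (mmpGo 0 0 1 0 pre) (map (y ∷_) (insertions w ys)) ≡ replicate (suc (length ys)) (suc (mmpGo 0 0 1 0 pre (y ∷ ys)))
  rest =
    begin
      map (mmpGo 0 0 1 0 pre) (map (y ∷_) (insertions w ys))
    ≡⟨ sym (map-∘ (insertions w ys)) ⟩
      map (λ σ → c + mmpGo 0 0 1 0 (pre ++ [ y ]) σ) (insertions w ys)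
    ≡⟨ map-∘ (insertions w ys) ⟩
      map (c +_) (map (mmpGo 0 0 1 0 (pre ++ [ y ])) (insertions w ys))
    ≡⟨ cong (map (c +_)) (mmp0010-insertions-max w (pre ++ [ y ]) ys pre′<w (λ q → hy (there q))) ⟩
      map (c +_) (((if (1 ≤ᵇ #lt w (pre ++ [ y ])) ∧ true then 1 else 0) + G) ∷ replicate (length ys) (suc G))
    ≡⟨ cong (λ z → map (c +_) (((if z ∧ true then 1 else 0) + G) ∷ replicate (length ys) (suc G))) y-before-w ⟩
      map (c +_) (replicate (suc (length ys)) (suc G))
    ≡⟨ trans (map-replicate (c +_) (suc (length ys)) (suc G)) (cong (replicate (suc (length ys))) (+-suc c G)) ⟩
      replicate (suc (length ys)) (suc (c + G))
    ∎
    where open ≡-Reasoning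

-- The case k = ℓ = 1

-- coefficient of x^m in Π_{j<n} (1 + j x)
stirlingCoeff : ℕ → ℕ → ℕ
stirlingCoeff zero    zero    = 1
stirlingCoeff zero    (suc m) = 0
stirlingCoeff (suc n) zero    = stirlingCoeff n zero
stirlingCoeff (suc n) (suc m) = stirlingCoeff n (suc m) + n * stirlingCoeff n m

xMul : (ℕ → ℕ) → ℕ → ℕ
xMul p zero    = 0
xMul p (suc m) = p m

xMul-cong : ∀ {p q : ℕ → ℕ} m → (∀ j → p j ≡ q j) → xMul p m ≡ xMul q m
xMul-cong zero    h = refl
xMul-cong (suc m) h = h m

stirlingCoeff-suc : ∀ n m → stirlingCoeff (suc n) m ≡ stirlingCoeff n m + n * xMul (stirlingCoeff n) m
stirlingCoeff-suc n zero    = sym (trans (cong (stirlingCoeff n 0 +_) (*-zeroʳ n)) (+-identityʳ _))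
stirlingCoeff-suc n (suc m) = refl

count-replicate : ∀ r x m → count (λ z → z) (replicate r x) m ≡ r * δ x m
count-replicate zero    x m = refl
count-replicate (suc r) x m = trans (count-∷ (λ z → z) x (replicate r x) m) (cong (δ x m +_) (count-replicate r x m))

count-concatMap-scale-1+ix : (st : List ℕ → ℕ) (ins : List ℕ → List (List ℕ)) (i : ℕ) (πs : List (List ℕ)) →
  (∀ {π} → π ∈ πs → map st (ins π) ↭ st π ∷ replicate i (suc (st π))) →
  ∀ m → count st (concatMap ins πs) m ≡ count st πs m + i * xMul (count st πs) m
count-concatMap-scale-1+ix st ins i []       h zero    = sym (*-zeroʳ i)
count-concatMap-scale-1+ix st ins i []       h (suc m) = sym (*-zeroʳ i)
count-concatMap-scale-1+ix st ins i (π ∷ πs) h m =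
  begin
    count st (ins π ++ concatMap ins πs) m
  ≡⟨ count-++ st (ins π) (concatMap ins πs) m ⟩
    count st (ins π) m + count st (concatMap ins πs) m
  ≡⟨ cong₂ _+_ count-ins (count-concatMap-scale-1+ix st ins i πs (λ q → h (there q)) m) ⟩
    (δ (st π) m + i * δ (suc (st π)) m) + (count st πs m + i * xMul (count st πs) m)
  ≡⟨ regroup (δ (st π) m) i (δ (suc (st π)) m) (count st πs m) (xMul (count st πs) m) ⟩
    (δ (st π) m + count st πs m) + i * (δ (suc (st π)) m + xMul (count st πs) m)
  ≡⟨ cong₂ (λ x y → x + i * y) (sym (count-∷ st π πs m)) (xMul-count-∷ m) ⟩
    count st (π ∷ πs) m + i * xMul (count st (π ∷ πs)) m
  ∎
  where
  open ≡-Reasoning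
  regroup : ∀ a i b c d → (a + i * b) + (c + i * d) ≡ (a + c) + i * (b + d)
  regroup = solve-∀
  count-ins : count st (ins π) m ≡ δ (st π) m + i * δ (suc (st π)) m
  count-ins = trans (sym (count-map (λ z → z) st (ins π) m))
    (trans (count-↭ (λ z → z) m (h (here refl)))
      (trans (count-∷ (λ z → z) (st π) (replicate i (suc (st π))) m) (cong (δ (st π) m +_) (count-replicate i (suc (st π)) m))))
  xMul-count-∷ : ∀ m → δ (suc (st π)) m + xMul (count st πs) m ≡ xMul (count st (π ∷ πs)) m
  xMul-count-∷ zero    = refl
  xMul-count-∷ (suc m) = sym (count-∷ st π πs m)

Rcoeff-insertion-step : ∀ a b c d x i → (∀ m → count (mmp a b c d) (permutations (x ∷ oneTo i)) m ≡ Rcoeff a b c d (suc i) m) →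
  (∀ {π} → π ∈ permutations (oneTo i) → map (mmp a b c d) (insertions x π) ↭ mmp a b c d π ∷ replicate i (suc (mmp a b c d π))) →
  (∀ m → Rcoeff a b c d i m ≡ stirlingCoeff i m) →
  ∀ m → Rcoeff a b c d (suc i) m ≡ stirlingCoeff (suc i) m
Rcoeff-insertion-step a b c d x i relabel insert ih m =
  begin
    Rcoeff a b c d (suc i) m
  ≡⟨ sym (relabel m) ⟩
    count st (concatMap (insertions x) (permutations (oneTo i))) m
  ≡⟨ count-concatMap-scale-1+ix st (insertions x) i (permutations (oneTo i)) insert m ⟩
    count st (permutations (oneTo i)) m + i * xMul (count st (permutations (oneTo i))) m
  ≡⟨ cong₂ (λ u v → u + i * v) (ih′ m) (xMul-cong m ih′) ⟩
    stirlingCoeff i m + i * xMul (stirlingCoeff i) m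
  ≡⟨ sym (stirlingCoeff-suc i m) ⟩
    stirlingCoeff (suc i) m
  ∎
  where
  open ≡-Reasoning
  st = mmp a b c d
  ih′ : ∀ j → count st (permutations (oneTo i)) j ≡ stirlingCoeff i j
  ih′ j = trans (count-mmp-Sym a b c d i j) (ih j)

length-∈-permutations-oneTo : ∀ i {π} → π ∈ permutations (oneTo i) → length π ≡ i
length-∈-permutations-oneTo i π∈ = trans (↭-length (∈-permutations⁻ (oneTo i) π∈)) (length-oneTo i)

∈-permutations-oneTo⇒bounds : ∀ i {π z} → π ∈ permutations (oneTo i) → z ∈ π → 1 ≤ z × z ≤ i
∈-permutations-oneTo⇒bounds i π∈ z∈ = ∈-oneTo⁻ i (∈-resp-↭ (∈-permutations⁻ (oneTo i) π∈) z∈)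

Rcoeff1000≡stirlingCoeff : ∀ n m → Rcoeff 1 0 0 0 n m ≡ stirlingCoeff n m
Rcoeff1000≡stirlingCoeff zero    zero    = refl
Rcoeff1000≡stirlingCoeff zero    (suc m) = refl
Rcoeff1000≡stirlingCoeff (suc i) =
  Rcoeff-insertion-step 1 0 0 0 0 i
    (λ m → trans (count-mmp-permutations 1 0 0 0 sorted m) (cong (λ l → Rcoeff 1 0 0 0 (suc l) m) (length-oneTo i)))
    insert (Rcoeff1000≡stirlingCoeff i)
  where
  sorted : Increasing (0 ∷ oneTo i)
  sorted = All.tabulate (λ z∈ → proj₁ (∈-oneTo⁻ i z∈)) ∷ Increasing-oneTo i
  insert : ∀ {π} → π ∈ permutations (oneTo i) → map (mmp 1 0 0 0) (insertions 0 π) ↭ mmp 1 0 0 0 π ∷ replicate i (suc (mmp 1 0 0 0 π))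
  insert {π} π∈ rewrite mmp1000-insertions-min 0 [] π (λ z∈ → proj₁ (∈-permutations-oneTo⇒bounds i π∈ z∈))
                      | length-∈-permutations-oneTo i π∈ = ++-comm (replicate i (suc (mmp 1 0 0 0 π))) [ mmp 1 0 0 0 π ]

Rcoeff0010≡stirlingCoeff : ∀ n m → Rcoeff 0 0 1 0 n m ≡ stirlingCoeff n m
Rcoeff0010≡stirlingCoeff zero    zero    = refl
Rcoeff0010≡stirlingCoeff zero    (suc m) = refl
Rcoeff0010≡stirlingCoeff (suc i) =
  Rcoeff-insertion-step 0 0 1 0 (suc i) i
    (λ m → trans (count-↭ (mmp 0 0 1 0) m (permutations-↭ unique (Unique-oneTo (suc i)) (↭-sym max-last)))
                 (count-mmp-Sym 0 0 1 0 (suc i) m))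
    insert (Rcoeff0010≡stirlingCoeff i)
  where
  unique : Unique (suc i ∷ oneTo i)
  unique = All.tabulate (λ z∈ e → <-irrefl (sym e) (s≤s (proj₂ (∈-oneTo⁻ i z∈)))) ∷ Unique-oneTo i
  max-last : oneTo (suc i) ↭ suc i ∷ oneTo i
  max-last = subst (λ z → oneTo (suc i) ↭ suc i ∷ z) (++-identityʳ (oneTo i)) (shift (suc i) (oneTo i) [])
  insert : ∀ {π} → π ∈ permutations (oneTo i) → map (mmp 0 0 1 0) (insertions (suc i) π) ↭ mmp 0 0 1 0 π ∷ replicate i (suc (mmp 0 0 1 0 π))
  insert {π} π∈ rewrite mmp0010-insertions-max (suc i) [] π (λ ()) (λ z∈ → s≤s (proj₂ (∈-permutations-oneTo⇒bounds i π∈ z∈)))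
                      | length-∈-permutations-oneTo i π∈ = ↭-refl

convCoeff-+*ˡ : ∀ (p q r : ℕ → ℕ) c m → convCoeff (λ t → p t + c * q t) r m ≡ convCoeff p r m + c * convCoeff q r m
convCoeff-+*ˡ p q r c m =
  trans (sumTo-cong m (λ j → distrib (p j) c (q j) (r (m ∸ j))))
    (trans (sumTo-+ m _ _) (cong (convCoeff p r m +_) (sumTo-* m c _)))
  where
  distrib : ∀ a c b d → (a + c * b) * d ≡ a * d + c * (b * d)
  distrib = solve-∀

convCoeff-+*ʳ : ∀ (p q r : ℕ → ℕ) c m → convCoeff p (λ t → q t + c * r t) m ≡ convCoeff p q m + c * convCoeff p r m
convCoeff-+*ʳ p q r c m =
  trans (sumTo-cong m (λ j → distrib (p j) (q (m ∸ j)) c (r (m ∸ j))))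
    (trans (sumTo-+ m _ _) (cong (convCoeff p q m +_) (sumTo-* m c _)))
  where
  distrib : ∀ a b c d → a * (b + c * d) ≡ a * b + c * (a * d)
  distrib = solve-∀

convCoeff-xMulˡ : ∀ (p q : ℕ → ℕ) m → convCoeff (xMul p) q m ≡ xMul (convCoeff p q) m
convCoeff-xMulˡ p q zero    = refl
convCoeff-xMulˡ p q (suc m) = sumTo-suc m (λ j → xMul p j * q (suc m ∸ j))

convCoeff-xMulʳ : ∀ (p q : ℕ → ℕ) m → convCoeff p (xMul q) m ≡ xMul (convCoeff p q) m
convCoeff-xMulʳ p q zero    = *-zeroʳ (p 0)
convCoeff-xMulʳ p q (suc m) =
  trans (cong₂ _+_ (sumTo-congᴵⁿ m _ _ (λ j j≤m → cong (λ z → p j * xMul q z) (+-∸-assoc 1 j≤m)))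
                   (trans (cong (λ z → p (suc m) * xMul q z) (n∸n≡0 m)) (*-zeroʳ (p (suc m)))))
        (+-identityʳ _)

convCoeff-stirlingCoeff-suc : ∀ i j m →
  convCoeff (stirlingCoeff (suc i)) (stirlingCoeff j) m + convCoeff (stirlingCoeff i) (stirlingCoeff (suc j)) m
    ≡ 2 * convCoeff (stirlingCoeff i) (stirlingCoeff j) m + (i + j) * xMul (convCoeff (stirlingCoeff i) (stirlingCoeff j)) m
convCoeff-stirlingCoeff-suc i j m =
  begin
    convCoeff (Q (suc i)) (Q j) m + convCoeff (Q i) (Q (suc j)) m
  ≡⟨ cong₂ _+_ (convCoeff-cong {q = Q j} m (stirlingCoeff-suc i) (λ _ → refl))
               (convCoeff-cong {p = Q i} m (λ _ → refl) (stirlingCoeff-suc j)) ⟩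
    convCoeff (λ t → Q i t + i * xMul (Q i) t) (Q j) m + convCoeff (Q i) (λ t → Q j t + j * xMul (Q j) t) m
  ≡⟨ cong₂ _+_ (trans (convCoeff-+*ˡ (Q i) (xMul (Q i)) (Q j) i m) (cong (λ z → H m + i * z) (convCoeff-xMulˡ (Q i) (Q j) m)))
               (trans (convCoeff-+*ʳ (Q i) (Q j) (xMul (Q j)) j m) (cong (λ z → H m + j * z) (convCoeff-xMulʳ (Q i) (Q j) m))) ⟩
    (H m + i * xMul H m) + (H m + j * xMul H m)
  ≡⟨ collect (H m) i j (xMul H m) ⟩
    2 * H m + (i + j) * xMul H m
  ∎
  where
  open ≡-Reasoning
  Q = stirlingCoeff
  H = convCoeff (Q i) (Q j)
  collect : ∀ a i j x → (a + i * x) + (a + j * x) ≡ 2 * a + (i + j) * x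
  collect = solve-∀

risingCoeff-suc : ∀ N m → risingCoeff (suc N) m ≡ 2 * risingCoeff N m + N * xMul (risingCoeff N) m
risingCoeff-suc N zero    = sym (trans (cong (2 * risingCoeff N 0 +_) (*-zeroʳ N)) (+-identityʳ _))
risingCoeff-suc N (suc m) = refl

sum-map-+ : ∀ (f g : A → ℕ) xs → sum (map (λ x → f x + g x) xs) ≡ sum (map f xs) + sum (map g xs)
sum-map-+ f g []       = refl
sum-map-+ f g (x ∷ xs) rewrite sum-map-+ f g xs = exchange (f x) (g x) (sum (map f xs)) (sum (map g xs))
  where
  exchange : ∀ a b c d → (a + b) + (c + d) ≡ (a + c) + (b + d)
  exchange = solve-∀

sum-map-* : ∀ c (f : A → ℕ) xs → sum (map (λ x → c * f x) xs) ≡ c * sum (map f xs)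
sum-map-* c f []       = sym (*-zeroʳ c)
sum-map-* c f (x ∷ xs) rewrite sum-map-* c f xs = sym (*-distribˡ-+ c (f x) _)

sum-map-xMul : ∀ (f : A → ℕ → ℕ) xs m → sum (map (λ x → xMul (f x) m) xs) ≡ xMul (λ t → sum (map (λ x → f x t) xs)) m
sum-map-xMul f []       zero    = refl
sum-map-xMul f []       (suc m) = refl
sum-map-xMul f (x ∷ xs) zero    = sum-map-xMul f xs zero
sum-map-xMul f (x ∷ xs) (suc m) = cong (f x m +_) (sum-map-xMul f xs (suc m))

splitConvolution : List ℕ → ℕ → ℕ
splitConvolution xs m = sum (map (λ p → convCoeff (stirlingCoeff (length (proj₁ p))) (stirlingCoeff (length (proj₂ p))) m) (splits xs))

splitConvolution≡risingCoeff : ∀ xs m → splitConvolution xs m ≡ risingCoeff (length xs) m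
splitConvolution≡risingCoeff []       zero    = refl
splitConvolution≡risingCoeff []       (suc m) =
  trans (+-identityʳ _) (trans (sumTo-cong (suc m) vanish) (sumTo-zero (suc m)))
  where
  vanish : ∀ j → stirlingCoeff 0 j * stirlingCoeff 0 (suc m ∸ j) ≡ 0
  vanish zero    = refl
  vanish (suc j) = refl
splitConvolution≡risingCoeff (x ∷ xs) m =
  begin
    sum (map G (map toLeft S ++ map toRight S))
  ≡⟨ trans (cong sum (map-++ G (map toLeft S) (map toRight S))) (sum-++ (map G (map toLeft S)) (map G (map toRight S))) ⟩
    sum (map G (map toLeft S)) + sum (map G (map toRight S))
  ≡⟨ sym (trans (sum-map-+ (λ p → G (toLeft p)) (λ p → G (toRight p)) S)
                 (cong₂ _+_ (cong sum (map-∘ S)) (cong sum (map-∘ S)))) ⟩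
    sum (map (λ p → G (toLeft p) + G (toRight p)) S)
  ≡⟨ cong sum (map-cong-local (All.tabulate λ {p} p∈ →
       trans (convCoeff-stirlingCoeff-suc (length (proj₁ p)) (length (proj₂ p)) m)
             (cong (λ z → 2 * H p m + z * xMul (H p) m) (splits-length xs p∈)))) ⟩
    sum (map (λ p → 2 * H p m + N * xMul (H p) m) S)
  ≡⟨ trans (sum-map-+ (λ p → 2 * H p m) (λ p → N * xMul (H p) m) S)
           (cong₂ _+_ (sum-map-* 2 (λ p → H p m) S) (sum-map-* N (λ p → xMul (H p) m) S)) ⟩
    2 * splitConvolution xs m + N * sum (map (λ p → xMul (H p) m) S)
  ≡⟨ cong₂ (λ u v → 2 * u + N * v) (splitConvolution≡risingCoeff xs m)
       (trans (sum-map-xMul H S m) (xMul-cong m (splitConvolution≡risingCoeff xs))) ⟩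
    2 * risingCoeff N m + N * xMul (risingCoeff N) m
  ≡⟨ sym (risingCoeff-suc N m) ⟩
    risingCoeff (suc N) m
  ∎
  where
  open ≡-Reasoning
  N = length xs
  S = splits xs
  H = λ (p : List ℕ × List ℕ) → convCoeff (stirlingCoeff (length (proj₁ p))) (stirlingCoeff (length (proj₂ p)))
  G = λ (p : List ℕ × List ℕ) → H p m
  toLeft = λ (p : List ℕ × List ℕ) → (x ∷ proj₁ p , proj₂ p)
  toRight = λ (p : List ℕ × List ℕ) → (proj₁ p , x ∷ proj₂ p)

binomial-convolution-stirlingCoeff : ∀ N m →
  sumTo N (λ i → (N C i) * convCoeff (stirlingCoeff i) (stirlingCoeff (N ∸ i)) m) ≡ risingCoeff N m
binomial-convolution-stirlingCoeff N m =
  begin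
    sumTo N (λ i → (N C i) * conv i (N ∸ i))
  ≡⟨ cong (λ z → sumTo z (λ i → (z C i) * conv i (z ∸ i))) (sym (length-oneTo N)) ⟩
    sumTo (length (oneTo N)) (λ i → (length (oneTo N) C i) * conv i (length (oneTo N) ∸ i))
  ≡⟨ sym (sum-splits conv (oneTo N)) ⟩
    splitConvolution (oneTo N) m
  ≡⟨ splitConvolution≡risingCoeff (oneTo N) m ⟩
    risingCoeff (length (oneTo N)) m
  ≡⟨ cong (λ z → risingCoeff z m) (length-oneTo N) ⟩
    risingCoeff N m
  ∎
  where
  open ≡-Reasoning
  conv = λ i j → convCoeff (stirlingCoeff i) (stirlingCoeff j) m

RbarCoeff-binomial-convolution : ∀ k ℓ n (τ ρ : List ℕ) a b → 1 ≤ k → τ ∈ Sym k → ρ ∈ Sym ℓ → a ≤ k → b ≤ ℓ →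
  mmp a 0 0 0 τ ≡ 0 → mmp 0 0 b 0 ρ ≡ 0 → k + ℓ ≤ n → ∀ m →
  RbarCoeff a 0 b 0 k τ ρ n m
    ≡ sumTo (n ∸ k ∸ ℓ) (λ i → ((n ∸ k ∸ ℓ) C i) * convCoeff (Rcoeff 0 0 b 0 i) (Rcoeff a 0 0 0 (n ∸ k ∸ ℓ ∸ i)) m)
RbarCoeff-binomial-convolution k ℓ n τ ρ a b 1≤k τ∈ ρ∈ a≤k b≤ℓ τ-avoids ρ-avoids k+ℓ≤n =
  BlockPermutations.RbarCoeff-convolution k ℓ n τ ρ 1≤k τ∈ ρ∈ k+ℓ≤n a b τ-avoids ρ-avoids a≤k b≤ℓ

RbarCoeff-n1≡risingCoeff : ∀ n → 2 ≤ n → ∀ m → RbarCoeff 1 0 1 0 1 [ 1 ] [ 1 ] n m ≡ risingCoeff (n ∸ 2) m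
RbarCoeff-n1≡risingCoeff (suc (suc N)) (s≤s (s≤s z≤n)) m =
  begin
    RbarCoeff 1 0 1 0 1 [ 1 ] [ 1 ] (2 + N) m
  ≡⟨ RbarCoeff-binomial-convolution 1 1 (2 + N) [ 1 ] [ 1 ] 1 1 ≤-refl (here refl) (here refl) ≤-refl ≤-refl refl refl
       (s≤s (s≤s z≤n)) m ⟩
    sumTo N (λ i → (N C i) * convCoeff (Rcoeff 0 0 1 0 i) (Rcoeff 1 0 0 0 (N ∸ i)) m)
  ≡⟨ sumTo-cong N (λ i → cong ((N C i) *_)
       (convCoeff-cong m (Rcoeff0010≡stirlingCoeff i) (Rcoeff1000≡stirlingCoeff (N ∸ i)))) ⟩
    sumTo N (λ i → (N C i) * convCoeff (stirlingCoeff i) (stirlingCoeff (N ∸ i)) m)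
  ≡⟨ binomial-convolution-stirlingCoeff N m ⟩
    risingCoeff N m
  ∎
  where open ≡-Reasoning

mainTheorem15 : (∀ (k ℓ : ℕ) (τ ρ : List ℕ) (a b : ℕ) →
      1 ≤ k → 1 ≤ ℓ → τ ∈ Sym k → ρ ∈ Sym ℓ →
      1 ≤ a → a ≤ k → 1 ≤ b → b ≤ ℓ →
      mmp a 0 0 0 τ ≡ 0 → mmp 0 0 b 0 ρ ≡ 0 →
      ∀ (n : ℕ) → k + ℓ ≤ n → ∀ (m : ℕ) →
        RbarCoeff a 0 b 0 k τ ρ n m
          ≡ sumTo (n ∸ k ∸ ℓ) (λ i →
              ((n ∸ k ∸ ℓ) C i)
                * convCoeff (Rcoeff 0 0 b 0 i) (Rcoeff a 0 0 0 (n ∸ k ∸ ℓ ∸ i)) m))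
    × (∀ (n : ℕ) → 2 ≤ n → ∀ (m : ℕ) →
        RbarCoeff 1 0 1 0 1 [ 1 ] [ 1 ] n m
          ≡ risingCoeff (n ∸ 2) m)
mainTheorem15 =
  (λ k ℓ τ ρ a b 1≤k _ τ∈ ρ∈ _ a≤k _ b≤ℓ τ-avoids ρ-avoids n k+ℓ≤n →
     RbarCoeff-binomial-convolution k ℓ n τ ρ a b 1≤k τ∈ ρ∈ a≤k b≤ℓ τ-avoids ρ-avoids k+ℓ≤n)
  , RbarCoeff-n1≡risingCoeff
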